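{- Let $k$ be a positive integer, let $\{f(n)\}$, $\{f^{\ast}(n)\}$ be $k$-periodic sequences of complex numbers, $A=\{f(n)\}$, $B=\{f^*(n)\}$, and for an integer $\gamma$ let $A_\gamma=\{f(\gamma n)\}$, $B_\gamma=\{f^*(\gamma n)\}$. Let $c$ and $d$ be coprime positive integers with $d\equiv0\pmod k$, and let $b$ be an integer with $bc\equiv-1\pmod d$. Then \begin{align*} &s(-c,d;A_{c},B_{ -b})-s(d,c;B_{b},A_{c})\\ &=P_{1}(0,B_{ -b})P_{1}(0,A_{ -c})-\frac{d}{c}B_{0}(A)P_{2}(0,B_{b})-\frac{c}{d}B_{0}(B)P_{2}(0,A_{c})-\frac{1}{2dc}B_{0}(B)B_{2}(A). \end{align*}
   Context: $P_n(x)=B_n(x-[x])/n!$ where $B_n(x)$ are the Bernoulli polynomials and $[x]$ is the floor. For a $k$-periodic $C=\{g(n)\}$: $B_j(C)$ is defined by $\sum_{n=0}^{k-1}\frac{t g(n)e^{nt}}{e^{kt}-1}=\sum_{j\ge0}B_j(C)\frac{t^j}{j!}$; $B_0(C)=\frac1k\sum_{m=0}^{k-1}g(m)$; and $P_r(x,C)=k^{r-1}\sum_{m=0}^{k-1}g(-m)P_r\!\left(\frac{m+x}{k}\right)$ for $r\ge1$ (e.g. $P_1(x,B_{ -b})=\sum_{m=0}^{k-1}f^*(bm)P_1(\frac{m+x}{k})$, $P_2(0,A_c)=k\sum_{m=0}^{k-1}f(-cm)P_2(\frac mk)$). For an integer $x$, a positive integer $y$ and $k$-periodic sequences $C=\{g(n)\}$,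 $D$: $s(x,y;C,D)=\sum_{n=1}^{yk}g(n)P_1\!\left(\frac{n}{yk}\right)P_1\!\left(\frac{xn}{y},D\right)$. Thus $s(d,c;B_b,A_c)=\sum_{n=1}^{ck}f^*(bn)P_1(\frac{n}{ck})P_1(\frac{dn}{c},A_c)$ and $s(-c,d;A_c,B_{ -b})=\sum_{n=1}^{dk}f(cn)P_1(\frac{n}{dk})P_1(-\frac{cn}{d},B_{ -b})$. -}

module Defs where

open import Level using (Level)
open import Algebra.Bundles using (CommutativeRing)
open import Algebra.Morphism.Structures using (module RingMorphisms)
open import Data.Nat as ℕ using (ℕ; zero; suc; NonZero)
open import Data.Nat.Properties using (m*n≢0)
open import Data.Integer as ℤ using (ℤ; +_)
open import Data.Rational as ℚ using (ℚ; _/_; floor; ½)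

frac : ℚ → ℚ
frac x = x ℚ.- (floor x / 1)

bern₁ : ℚ → ℚ
bern₁ x = x ℚ.- ½

bern₂ : ℚ → ℚ
bern₂ x = x ℚ.* x ℚ.- x ℚ.+ (+ 1 / 6)

-- P_n(x) = B_n(x - [x]) / n!
P₁ : ℚ → ℚ
P₁ x = bern₁ (frac x)

P₂ : ℚ → ℚ
P₂ x = bern₂ (frac x) ℚ.* (+ 1 / 2)

ℤ→ℚ : ℤ → ℚ
ℤ→ℚ z = z / 1

ℕ→ℚ : ℕ → ℚ
ℕ→ℚ n = + n / 1

-- Everything over a commutative ring R receiving a ring homomorphism
-- ι : ℚ → R (a ℚ-algebra; ℂ is the case of the paper).

IsQAlgebraMap : ∀ {c ℓ} (R : CommutativeRing c ℓ) →
                (ℚ → CommutativeRing.Carrier R) → Set _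
IsQAlgebraMap R ι =
  RingMorphisms.IsRingHomomorphism ℚ.+-*-rawRing (CommutativeRing.rawRing R) ι

module WithRing {c ℓ} (R : CommutativeRing c ℓ)
                (ι : ℚ → CommutativeRing.Carrier R) where
  open CommutativeRing R

  Σ< : ℕ → (ℕ → Carrier) → Carrier
  Σ< zero    h = 0#
  Σ< (suc n) h = Σ< n h + h n

  Σ₁ : ℕ → (ℕ → Carrier) → Carrier
  Σ₁ n h = Σ< n (λ m → h (suc m))

  Seq : Set c
  Seq = ℤ → Carrier

  Periodic : ℕ → Seq → Set ℓ
  Periodic k g = ∀ n → g (n ℤ.+ + k) ≈ g n

  dil : ℤ → Seq → Seq
  dil γ g n = g (γ ℤ.* n)

  Bern₀ : (k : ℕ) .{{_ : NonZero k}} → Seq → Carrier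
  Bern₀ k g = ι (+ 1 / k) * Σ< k (λ m → g (+ m))

  -- B₂(C): the coefficient of t²/2! in Σ_{n<k} t g(n) e^{nt}/(e^{kt}-1),
  -- which equals k Σ_{n=0}^{k-1} g(n) B₂(n/k).
  Bern₂ : (k : ℕ) .{{_ : NonZero k}} → Seq → Carrier
  Bern₂ k g = ι (ℕ→ℚ k) * Σ< k (λ n → g (+ n) * ι (bern₂ (+ n / k)))

  P₁C : (k : ℕ) .{{_ : NonZero k}} → ℚ → Seq → Carrier
  P₁C k x g = Σ< k (λ m → g (ℤ.- (+ m)) *
                       ι (P₁ ((ℕ→ℚ m ℚ.+ x) ℚ.* (+ 1 / k))))

  P₂C : (k : ℕ) .{{_ : NonZero k}} → ℚ → Seq → Carrier
  P₂C k x g = ι (ℕ→ℚ k) *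
              Σ< k (λ m → g (ℤ.- (+ m)) *
                       ι (P₂ ((ℕ→ℚ m ℚ.+ x) ℚ.* (+ 1 / k))))

  sDed : (k : ℕ) .{{_ : NonZero k}} → (x : ℤ) (y : ℕ) .{{_ : NonZero y}} →
         Seq → Seq → Carrier
  sDed k x y g h =
    Σ₁ (y ℕ.* k) (λ n →
      g (+ n) * ι (P₁ (_/_ (+ n) (y ℕ.* k) {{m*n≢0 y k}})) * P₁C k ((x ℤ.* (+ n)) / y) h)

{-# OPTIONS --safe #-}
-- For integers α + β + γ = 0 and fractional parts x, y, z of α/M, β/M, γ/M (so s = x + y + z ∈ {0, 1, 2}),
--   P₁(α/M)P₁(β/M) + P₁(β/M)P₁(γ/M) + P₁(γ/M)P₁(α/M) + P₂(α/M) + P₂(β/M) + P₂(γ/M) = ½ (s − 1)(s − 2),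
-- which is 1 if M divides α and β and 0 otherwise. Take M = cdk, α = cn, β = −dm, γ = dm − cn and sum
-- with weights f(cn) f*(bm) over n < dk, m < ck: only n = m = 0 survives, so the sum is f(0) f*(0).
-- Expanding the left side gives six double sums. Splitting each range into blocks of length k and using
-- the Raabe relations Σ_{q<a} P_r((x + q)/a) = a^{1−r} P_r(x) (r = 1, 2), with q permuted by a unit mod a,
-- two of them become the sums s(−c, d; A_c, B_{−b}) and s(d, c; B_b, A_c) and the rest become the products
-- on the right-hand side. The units needed (b and c mod k, d mod c) come from bc ≡ −1 (mod d) and k ∣ d.
module Submission where

open import Defs
open import Algebra.Bundles using (CommutativeRing)
open import Algebra.Morphism.Structures using (module RingMorphisms)
import Algebra.Solver.Ring as Ring-Solver
import Algebra.Solver.Ring.AlmostCommutativeRing as ACR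
open import Data.Empty using (⊥-elim)
open import Data.Fin using (Fin; toℕ; fromℕ<)
import Data.Fin.Properties as FinP
open import Data.Fin.Permutation using (permutation)
open import Data.Integer as ℤ using (ℤ; +_; -[1+_]; +[1+_])
import Data.Integer.Properties as ℤP
open import Data.Integer.DivMod using (n%ℕd<d; a≡a%ℕn+[a/ℕn]*n; div-pos-is-/ℕ)
open import Data.Integer.Divisibility as ℤD using ()
open import Data.Integer.Divisibility.Signed using (∣ᵤ⇒∣; divides)
open import Data.Integer.Tactic.RingSolver using (solve-∀)
open import Data.Maybe using (Maybe; just; nothing)
open import Data.Nat as ℕ using (ℕ; zero; suc; NonZero)
open import Data.Nat.Coprimality using (Coprime)
open import Data.Nat.Divisibility as ℕD using ()
import Data.Nat.GCD as GCD
import Data.Nat.Properties as ℕP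
open import Data.Nat.Properties using (m*n≢0)
import Data.Nat.Tactic.RingSolver as ℕ-Solver
open import Data.Product using (Σ; _×_; _,_; proj₁; proj₂)
open import Data.Rational as ℚ using (ℚ; _/_; 0ℚ; floor; ↥_; ↧_; ↧ₙ_)
import Data.Rational.Properties as ℚP
open import Data.Rational.Unnormalised as ℚᵘ using (mkℚᵘ; *≡*)
import Data.Rational.Unnormalised.Properties as ℚᵘP
open import Data.Sum using (_⊎_; inj₁; inj₂)
open import Relation.Binary.PropositionalEquality as ≡ using (_≡_)
open import Relation.Nullary using (¬_; yes; no)

-- Euclidean division, fractional parts and the three-term relation

module _ where
  open ≡

  private
    move-multiple : ∀ x y δ N → x ≡ y ℤ.+ δ ℤ.* N → y ≡ x ℤ.+ (ℤ.- δ) ℤ.* N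
    move-multiple x y δ N refl = lemma y δ N
      where lemma : ∀ y δ N → y ≡ (y ℤ.+ δ ℤ.* N) ℤ.+ (ℤ.- δ) ℤ.* N
            lemma = solve-∀

    wrap-bound : ∀ {N r r'} n → + r ≡ + r' ℤ.+ + suc n ℤ.* + N → N ℕ.≤ r
    wrap-bound {N} {r} {r'} n e = begin
      N                     ≤⟨ ℕP.m≤n*m N (suc n) ⟩
      suc n ℕ.* N           ≤⟨ ℕP.m≤n+m _ r' ⟩
      r' ℕ.+ suc n ℕ.* N    ≡⟨ ℤP.+-injective (trans (ℤP.pos-+ r' _) (trans (cong (ℤ._+_ (+ r')) (ℤP.pos-* (suc n) N)) (sym e))) ⟩
      r                     ∎
      where open ℕP.≤-Reasoning

    residues-agree : ∀ {N r r'} δ → r ℕ.< N → r' ℕ.< N → + r ≡ + r' ℤ.+ δ ℤ.* + N → δ ≡ + 0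
    residues-agree (+ zero)  _   _    _ = refl
    residues-agree +[1+ n ]  r<N _    e = ⊥-elim (ℕP.<⇒≱ r<N (wrap-bound n e))
    residues-agree {N} {r} {r'} -[1+ n ]  _   r'<N e = ⊥-elim (ℕP.<⇒≱ r'<N (wrap-bound n (move-multiple (+ r) (+ r') -[1+ n ] (+ N) e)))

  divMod-unique : ∀ N .{{_ : NonZero N}} {a r} q → r ℕ.< N → a ≡ + r ℤ.+ q ℤ.* + N →
                  a ℤ.%ℕ N ≡ r × a ℤ./ℕ N ≡ q
  divMod-unique N {a} {r} q r<N a≡ =
    sym (ℤP.+-injective (trans r≡ (trans (cong (λ δ → + r' ℤ.+ δ ℤ.* + N) δ≡0) (ℤP.+-identityʳ (+ r'))))) ,
    ℤP.i-j≡0⇒i≡j _ _ δ≡0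
    where
    r' = a ℤ.%ℕ N
    q' = a ℤ./ℕ N
    compare : ∀ x y q q' N → x ℤ.+ q ℤ.* N ≡ y ℤ.+ q' ℤ.* N → x ≡ y ℤ.+ (q' ℤ.- q) ℤ.* N
    compare x y q q' N e = trans (lemma x q N) (trans (cong (ℤ._- q ℤ.* N) e) (lemma′ y q q' N))
      where lemma : ∀ x q N → x ≡ (x ℤ.+ q ℤ.* N) ℤ.- q ℤ.* N
            lemma = solve-∀
            lemma′ : ∀ y q q' N → (y ℤ.+ q' ℤ.* N) ℤ.- q ℤ.* N ≡ y ℤ.+ (q' ℤ.- q) ℤ.* N
            lemma′ = solve-∀
    r≡ : + r ≡ + r' ℤ.+ (q' ℤ.- q) ℤ.* + N
    r≡ = compare (+ r) (+ r') q q' (+ N) (trans (sym a≡) (a≡a%ℕn+[a/ℕn]*n a N))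
    δ≡0 : q' ℤ.- q ≡ + 0
    δ≡0 = residues-agree _ r<N (n%ℕd<d a N) r≡

  +[a%ℕN]≡a-[a/ℕN]*N : ∀ a N .{{_ : NonZero N}} → + (a ℤ.%ℕ N) ≡ a ℤ.+ (ℤ.- (a ℤ./ℕ N)) ℤ.* + N
  +[a%ℕN]≡a-[a/ℕN]*N a N = move-multiple a (+ (a ℤ.%ℕ N)) (a ℤ./ℕ N) (+ N) (a≡a%ℕn+[a/ℕn]*n a N)

  [a+tN]%ℕN≡a%ℕN : ∀ a t N .{{_ : NonZero N}} → (a ℤ.+ t ℤ.* + N) ℤ.%ℕ N ≡ a ℤ.%ℕ N
  [a+tN]%ℕN≡a%ℕN a t N = proj₁ (divMod-unique N (a ℤ./ℕ N ℤ.+ t) (n%ℕd<d a N)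
    (trans (cong (ℤ._+ t ℤ.* + N) (a≡a%ℕn+[a/ℕn]*n a N)) (lemma (+ (a ℤ.%ℕ N)) (a ℤ./ℕ N) t (+ N))))
    where lemma : ∀ r q t N → (r ℤ.+ q ℤ.* N) ℤ.+ t ℤ.* N ≡ r ℤ.+ (q ℤ.+ t) ℤ.* N
          lemma = solve-∀

  n<N⇒+n%ℕN≡n : ∀ {n N} .{{_ : NonZero N}} → n ℕ.< N → (+ n) ℤ.%ℕ N ≡ n
  n<N⇒+n%ℕN≡n {n} {N} n<N = proj₁ (divMod-unique N (+ 0) n<N (sym (ℤP.+-identityʳ (+ n))))

  -[1+n]%ℕN≡N∸[1+n] : ∀ {n N} .{{_ : NonZero N}} → suc n ℕ.≤ N → (ℤ.- + suc n) ℤ.%ℕ N ≡ N ℕ.∸ suc n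
  -[1+n]%ℕN≡N∸[1+n] {n} {N@(suc N-1)} n<N = proj₁ (divMod-unique N (ℤ.- + 1) (ℕ.s≤s (ℕP.m∸n≤m N-1 n))
    (trans (lemma (+ suc n) (+ N)) (cong (ℤ._+ ℤ.- + 1 ℤ.* + N) (trans (ℤP.m-n≡m⊖n N (suc n)) (ℤP.⊖-≥ n<N)))))
    where lemma : ∀ n N → ℤ.- n ≡ (N ℤ.- n) ℤ.+ ℤ.- + 1 ℤ.* N
          lemma = solve-∀

  a%ℕN≡0⇒-a%ℕN≡0 : ∀ a N .{{_ : NonZero N}} → a ℤ.%ℕ N ≡ 0 → (ℤ.- a) ℤ.%ℕ N ≡ 0
  a%ℕN≡0⇒-a%ℕN≡0 a N a%N≡0 = proj₁ (divMod-unique N (ℤ.- (a ℤ./ℕ N)) (ℕ.>-nonZero⁻¹ N)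
    (trans (cong ℤ.-_ (trans (a≡a%ℕn+[a/ℕn]*n a N) (cong (λ r → + r ℤ.+ a ℤ./ℕ N ℤ.* + N) a%N≡0)))
           (lemma (a ℤ./ℕ N) (+ N))))
    where lemma : ∀ q N → ℤ.- (+ 0 ℤ.+ q ℤ.* N) ≡ + 0 ℤ.+ (ℤ.- q) ℤ.* N
          lemma = solve-∀

  private
    toℚᵘ-/ : ∀ a M .{{_ : NonZero M}} → ℚ.toℚᵘ (a / M) ℚᵘ.≃ (a ℚᵘ./ M)
    toℚᵘ-/ a (suc m) = ℚP.toℚᵘ-fromℚᵘ (mkℚᵘ a m)

  cross-multiply : ∀ a b M N .{{_ : NonZero M}} .{{_ : NonZero N}} →
                   a ℤ.* + N ≡ b ℤ.* + M → a / M ≡ b / N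
  cross-multiply a b (suc m) (suc n) e = ℚP.fromℚᵘ-cong {mkℚᵘ a m} {mkℚᵘ b n} (*≡* e)

  /-+-/ : ∀ a b M N .{{_ : NonZero M}} .{{_ : NonZero N}} →
          a / M ℚ.+ b / N ≡ _/_ (a ℤ.* + N ℤ.+ b ℤ.* + M) (M ℕ.* N) {{m*n≢0 M N}}
  /-+-/ a b M@(suc _) N@(suc _) = ℚP.toℚᵘ-injective (ℚᵘP.≃-trans (ℚP.toℚᵘ-homo-+ (a / M) (b / N))
    (ℚᵘP.≃-trans (ℚᵘP.+-cong (toℚᵘ-/ a M) (toℚᵘ-/ b N)) (ℚᵘP.≃-sym (toℚᵘ-/ _ (M ℕ.* N)))))

  /-*-/ : ∀ a b M N .{{_ : NonZero M}} .{{_ : NonZero N}} →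
          (a / M) ℚ.* (b / N) ≡ _/_ (a ℤ.* b) (M ℕ.* N) {{m*n≢0 M N}}
  /-*-/ a b M@(suc _) N@(suc _) = ℚP.toℚᵘ-injective (ℚᵘP.≃-trans (ℚP.toℚᵘ-homo-* (a / M) (b / N))
    (ℚᵘP.≃-trans (ℚᵘP.*-cong (toℚᵘ-/ a M) (toℚᵘ-/ b N)) (ℚᵘP.≃-sym (toℚᵘ-/ (a ℤ.* b) (M ℕ.* N)))))

  -‿/ : ∀ a M .{{_ : NonZero M}} → ℚ.- (a / M) ≡ (ℤ.- a) / M
  -‿/ a M@(suc _) = ℚP.toℚᵘ-injective (ℚᵘP.≃-trans (ℚP.toℚᵘ-homo‿- (a / M))
    (ℚᵘP.≃-trans (ℚᵘP.-‿cong (toℚᵘ-/ a M)) (ℚᵘP.≃-sym (toℚᵘ-/ (ℤ.- a) M))))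

  /---/ : ∀ a b M N .{{_ : NonZero M}} .{{_ : NonZero N}} →
          a / M ℚ.- b / N ≡ _/_ (a ℤ.* + N ℤ.- b ℤ.* + M) (M ℕ.* N) {{m*n≢0 M N}}
  /---/ a b M N = trans (cong (a / M ℚ.+_) (-‿/ b N)) (trans (/-+-/ a (ℤ.- b) M N)
    (cong (λ z → _/_ (a ℤ.* + N ℤ.+ z) (M ℕ.* N) {{m*n≢0 M N}}) (sym (ℤP.neg-distribˡ-* b (+ M)))))

  private
    floor-reduced : ∀ p → floor p ≡ ↥ p ℤ./ ↧ p
    floor-reduced record{} = refl

  floor-/ : ∀ a M .{{_ : NonZero M}} → floor (a / M) ≡ a ℤ./ℕ M
  floor-/ a M = trans (floor-reduced p) (trans (div-pos-is-/ℕ (↥ p) D)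
                  (sym (proj₂ (divMod-unique M q rg<M a≡))))
    where
    open ≡-Reasoning
    p = a / M
    D = ↧ₙ p
    g = GCD.gcd ℤ.∣ a ∣ M
    r = ↥ p ℤ.%ℕ D
    q = ↥ p ℤ./ℕ D
    Dg≡M : D ℕ.* g ≡ M
    Dg≡M = ℤP.+-injective (trans (ℤP.pos-* D g) (ℚP.↧-/ a M))
    g≢0 : NonZero g
    g≢0 with g | Dg≡M
    ... | zero  | e = ⊥-elim (ℕ.≢-nonZero⁻¹ M (trans (sym e) (ℕP.*-zeroʳ D)))
    ... | suc _ | _ = _
    rg<M : r ℕ.* g ℕ.< M
    rg<M = subst (r ℕ.* g ℕ.<_) Dg≡M (ℕP.*-monoˡ-< g {{g≢0}} (n%ℕd<d (↥ p) D))
    a≡ : a ≡ + (r ℕ.* g) ℤ.+ q ℤ.* + M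
    a≡ = begin
      a                                  ≡⟨ sym (ℚP.↥-/ a M) ⟩
      ↥ p ℤ.* + g                        ≡⟨ cong (ℤ._* + g) (a≡a%ℕn+[a/ℕn]*n (↥ p) D) ⟩
      (+ r ℤ.+ q ℤ.* + D) ℤ.* + g        ≡⟨ lemma (+ r) q (+ D) (+ g) ⟩
      + r ℤ.* + g ℤ.+ q ℤ.* (+ D ℤ.* + g) ≡⟨ cong₂ (λ x y → x ℤ.+ q ℤ.* y) (sym (ℤP.pos-* r g))
                                               (trans (sym (ℤP.pos-* D g)) (cong +_ Dg≡M)) ⟩
      + (r ℕ.* g) ℤ.+ q ℤ.* + M          ∎
      where lemma : ∀ x y z w → (x ℤ.+ y ℤ.* z) ℤ.* w ≡ x ℤ.* w ℤ.+ y ℤ.* (z ℤ.* w)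
            lemma = solve-∀

  frac-/ : ∀ a M .{{_ : NonZero M}} → frac (a / M) ≡ + (a ℤ.%ℕ M) / M
  frac-/ a M = begin
    a / M ℚ.- floor (a / M) / 1   ≡⟨ cong (λ z → a / M ℚ.- z / 1) (floor-/ a M) ⟩
    a / M ℚ.- q / 1               ≡⟨ /---/ a q M 1 ⟩
    _/_ (a ℤ.* + 1 ℤ.- q ℤ.* + M) (M ℕ.* 1) {{m*n≢0 M 1}}
      ≡⟨ cross-multiply (a ℤ.* + 1 ℤ.- q ℤ.* + M) (+ r) (M ℕ.* 1) M {{m*n≢0 M 1}} (begin
           (a ℤ.* + 1 ℤ.- q ℤ.* + M) ℤ.* + M
             ≡⟨ cong (λ z → (z ℤ.* + 1 ℤ.- q ℤ.* + M) ℤ.* + M) (a≡a%ℕn+[a/ℕn]*n a M) ⟩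
           ((+ r ℤ.+ q ℤ.* + M) ℤ.* + 1 ℤ.- q ℤ.* + M) ℤ.* + M ≡⟨ lemma (+ r) q (+ M) ⟩
           + r ℤ.* (+ M ℤ.* + 1)                               ≡⟨ cong (+ r ℤ.*_) (sym (ℤP.pos-* M 1)) ⟩
           + r ℤ.* + (M ℕ.* 1)                                 ∎) ⟩
    + r / M                       ∎
    where
    open ≡-Reasoning
    q = a ℤ./ℕ M
    r = a ℤ.%ℕ M
    lemma : ∀ x y z → ((x ℤ.+ y ℤ.* z) ℤ.* + 1 ℤ.- y ℤ.* z) ℤ.* z ≡ x ℤ.* (z ℤ.* + 1)
    lemma = solve-∀

  frac-periodic : ∀ a t M .{{_ : NonZero M}} → frac ((a ℤ.+ t ℤ.* + M) / M) ≡ frac (a / M)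
  frac-periodic a t M = trans (frac-/ (a ℤ.+ t ℤ.* + M) M)
    (trans (cong (λ r → + r / M) ([a+tN]%ℕN≡a%ℕN a t M)) (sym (frac-/ a M)))

  n<N⇒frac[n/N]≡n/N : ∀ {n N} .{{_ : NonZero N}} → n ℕ.< N → frac (+ n / N) ≡ + n / N
  n<N⇒frac[n/N]≡n/N {n} {N} n<N = trans (frac-/ (+ n) N) (cong (λ r → + r / N) (n<N⇒+n%ℕN≡n n<N))

  frac[-n/N]≡1-n/N : ∀ {n N} .{{_ : NonZero N}} → suc n ℕ.≤ N → frac ((ℤ.- + suc n) / N) ≡ ℚ.1ℚ ℚ.- + suc n / N
  frac[-n/N]≡1-n/N {n} {N} {{N≢0}} n<N = begin
    frac ((ℤ.- + suc n) / N)   ≡⟨ frac-/ (ℤ.- + suc n) N ⟩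
    + ((ℤ.- + suc n) ℤ.%ℕ N) / N ≡⟨ cong (λ r → + r / N) (-[1+n]%ℕN≡N∸[1+n] n<N) ⟩
    + (N ℕ.∸ suc n) / N        ≡⟨ cross-multiply (+ (N ℕ.∸ suc n)) (+ 1 ℤ.* + N ℤ.- + suc n ℤ.* + 1) N (1 ℕ.* N) {{N≢0}} {{m*n≢0 1 N}} (begin
         + (N ℕ.∸ suc n) ℤ.* + (1 ℕ.* N)         ≡⟨ cong₂ ℤ._*_ (sym (trans (ℤP.m-n≡m⊖n N (suc n)) (ℤP.⊖-≥ n<N)))
                                                                (ℤP.pos-* 1 N) ⟩
         (+ N ℤ.- + suc n) ℤ.* (+ 1 ℤ.* + N)      ≡⟨ lemma (+ N) (+ suc n) ⟩
         (+ 1 ℤ.* + N ℤ.- + suc n ℤ.* + 1) ℤ.* + N ∎) ⟩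
    _/_ (+ 1 ℤ.* + N ℤ.- + suc n ℤ.* + 1) (1 ℕ.* N) {{m*n≢0 1 N}} ≡⟨ sym (/---/ (+ 1) (+ suc n) 1 N) ⟩
    ℚ.1ℚ ℚ.- + suc n / N       ∎
    where
    open ≡-Reasoning
    lemma : ∀ N n → (N ℤ.- n) ℤ.* (+ 1 ℤ.* N) ≡ (+ 1 ℤ.* N ℤ.- n ℤ.* + 1) ℤ.* N
    lemma = solve-∀

  P₁-periodic : ∀ a t M .{{_ : NonZero M}} → P₁ ((a ℤ.+ t ℤ.* + M) / M) ≡ P₁ (a / M)
  P₁-periodic a t M = cong bern₁ (frac-periodic a t M)

  P₂-periodic : ∀ a t M .{{_ : NonZero M}} → P₂ ((a ℤ.+ t ℤ.* + M) / M) ≡ P₂ (a / M)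
  P₂-periodic a t M = cong (λ x → bern₂ x ℚ.* (+ 1 / 2)) (frac-periodic a t M)

  P₁[0/N]≡-½ : ∀ N .{{_ : NonZero N}} → P₁ (+ 0 / N) ≡ ℚ.- ℚ.½
  P₁[0/N]≡-½ N = cong P₁ (ℚP.0/n≡0 N)

  module _ where
    open import Data.Rational.Solver
    open +-*-Solver

    bern₁-reflect : ∀ x → bern₁ (ℚ.1ℚ ℚ.- x) ≡ ℚ.- bern₁ x
    bern₁-reflect = solve 1 (λ x → (con ℚ.1ℚ :- x) :- con ℚ.½ := :- (x :- con ℚ.½)) refl

    bern₂-reflect : ∀ x → bern₂ (ℚ.1ℚ ℚ.- x) ≡ bern₂ x
    bern₂-reflect = solve 1 (λ x → (con ℚ.1ℚ :- x) :* (con ℚ.1ℚ :- x) :- (con ℚ.1ℚ :- x) :+ con (+ 1 / 6)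
                                := x :* x :- x :+ con (+ 1 / 6)) refl

  P₁-odd : ∀ {n N} .{{_ : NonZero N}} → suc n ℕ.< N → P₁ ((ℤ.- + suc n) / N) ≡ ℚ.- P₁ (+ suc n / N)
  P₁-odd {n} {N} n<N = trans (cong bern₁ (frac[-n/N]≡1-n/N (ℕP.<⇒≤ n<N)))
    (trans (bern₁-reflect (+ suc n / N)) (cong (λ x → ℚ.- bern₁ x) (sym (n<N⇒frac[n/N]≡n/N n<N))))

  P₂-even : ∀ a M .{{_ : NonZero M}} → P₂ ((ℤ.- a) / M) ≡ P₂ (a / M)
  P₂-even a M = cong (λ x → x ℚ.* (+ 1 / 2)) (begin
    bern₂ (frac ((ℤ.- a) / M))            ≡⟨ cong (λ x → bern₂ (frac (x / M))) -a≡ ⟩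
    bern₂ (frac ((ℤ.- + r ℤ.+ ℤ.- q ℤ.* + M) / M)) ≡⟨ cong bern₂ (frac-periodic (ℤ.- + r) (ℤ.- q) M) ⟩
    bern₂ (frac ((ℤ.- + r) / M))          ≡⟨ even-residue r (n%ℕd<d a M) ⟩
    bern₂ (frac (+ r / M))                ≡⟨ cong bern₂ (trans (n<N⇒frac[n/N]≡n/N (n%ℕd<d a M)) (sym (frac-/ a M))) ⟩
    bern₂ (frac (a / M))                  ∎)
    where
    open ≡-Reasoning
    r = a ℤ.%ℕ M
    q = a ℤ./ℕ M
    -a≡ : ℤ.- a ≡ ℤ.- + r ℤ.+ ℤ.- q ℤ.* + M
    -a≡ = trans (cong ℤ.-_ (a≡a%ℕn+[a/ℕn]*n a M)) (lemma (+ r) q (+ M))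
      where lemma : ∀ r q M → ℤ.- (r ℤ.+ q ℤ.* M) ≡ ℤ.- r ℤ.+ ℤ.- q ℤ.* M
            lemma = solve-∀
    even-residue : ∀ r → r ℕ.< M → bern₂ (frac ((ℤ.- + r) / M)) ≡ bern₂ (frac (+ r / M))
    even-residue zero    _   = refl
    even-residue (suc r) r<M = begin
      bern₂ (frac ((ℤ.- + suc r) / M)) ≡⟨ cong bern₂ (frac[-n/N]≡1-n/N (ℕP.<⇒≤ r<M)) ⟩
      bern₂ (ℚ.1ℚ ℚ.- + suc r / M)     ≡⟨ bern₂-reflect (+ suc r / M) ⟩
      bern₂ (+ suc r / M)              ≡⟨ cong bern₂ (sym (n<N⇒frac[n/N]≡n/N r<M)) ⟩
      bern₂ (frac (+ suc r / M))       ∎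

  /-+-/-same : ∀ a b M .{{_ : NonZero M}} → a / M ℚ.+ b / M ≡ (a ℤ.+ b) / M
  /-+-/-same a b M = trans (/-+-/ a b M M) (cross-multiply (a ℤ.* + M ℤ.+ b ℤ.* + M) (a ℤ.+ b) (M ℕ.* M) M {{m*n≢0 M M}}
    (trans (lemma a b (+ M)) (cong ((a ℤ.+ b) ℤ.*_) (sym (ℤP.pos-* M M)))))
    where lemma : ∀ x y z → (x ℤ.* z ℤ.+ y ℤ.* z) ℤ.* z ≡ (x ℤ.+ y) ℤ.* (z ℤ.* z)
          lemma = solve-∀

  residues-sum-to-multiple : ∀ M .{{_ : NonZero M}} α β γ → α ℤ.+ β ℤ.+ γ ≡ + 0 →
                             Σ ℕ λ t → α ℤ.%ℕ M ℕ.+ β ℤ.%ℕ M ℕ.+ γ ℤ.%ℕ M ≡ t ℕ.* M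
  residues-sum-to-multiple M@(suc _) α β γ α+β+γ≡0 = by-sign T refl
    where
    open ≡-Reasoning
    A = α ℤ.%ℕ M
    B = β ℤ.%ℕ M
    C = γ ℤ.%ℕ M
    T = ℤ.- (α ℤ./ℕ M ℤ.+ β ℤ./ℕ M ℤ.+ γ ℤ./ℕ M)
    ABC≡TM : + (A ℕ.+ B ℕ.+ C) ≡ T ℤ.* + M
    ABC≡TM = begin
      + (A ℕ.+ B ℕ.+ C)     ≡⟨ trans (ℤP.pos-+ (A ℕ.+ B) C) (cong (ℤ._+ + C) (ℤP.pos-+ A B)) ⟩
      + A ℤ.+ + B ℤ.+ + C   ≡⟨ lemma (+ A) (+ B) (+ C) (α ℤ./ℕ M) (β ℤ./ℕ M) (γ ℤ./ℕ M) (+ M) ⟩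
      (+ A ℤ.+ α ℤ./ℕ M ℤ.* + M) ℤ.+ (+ B ℤ.+ β ℤ./ℕ M ℤ.* + M) ℤ.+ (+ C ℤ.+ γ ℤ./ℕ M ℤ.* + M) ℤ.+ T ℤ.* + M
        ≡⟨ cong (ℤ._+ T ℤ.* + M) (trans (sym (cong₂ ℤ._+_ (cong₂ ℤ._+_ (a≡a%ℕn+[a/ℕn]*n α M) (a≡a%ℕn+[a/ℕn]*n β M))
                                                      (a≡a%ℕn+[a/ℕn]*n γ M))) α+β+γ≡0) ⟩
      + 0 ℤ.+ T ℤ.* + M      ≡⟨ ℤP.+-identityˡ _ ⟩
      T ℤ.* + M              ∎
      where lemma : ∀ A B C qa qb qc M → A ℤ.+ B ℤ.+ C ≡
                      (A ℤ.+ qa ℤ.* M) ℤ.+ (B ℤ.+ qb ℤ.* M) ℤ.+ (C ℤ.+ qc ℤ.* M) ℤ.+ (ℤ.- (qa ℤ.+ qb ℤ.+ qc)) ℤ.* M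
            lemma = solve-∀
    by-sign : ∀ t → T ≡ t → Σ ℕ λ t → A ℕ.+ B ℕ.+ C ≡ t ℕ.* M
    by-sign -[1+ _ ] T≡ with () ← trans ABC≡TM (cong (ℤ._* + M) T≡)
    by-sign (+ t)    T≡ = t , ℤP.+-injective (trans ABC≡TM (trans (cong (ℤ._* + M) T≡) (sym (ℤP.pos-* t M))))

  frac-/-sum : ∀ M .{{_ : NonZero M}} α β γ →
               frac (α / M) ℚ.+ frac (β / M) ℚ.+ frac (γ / M) ≡ + (α ℤ.%ℕ M ℕ.+ β ℤ.%ℕ M ℕ.+ γ ℤ.%ℕ M) / M
  frac-/-sum M α β γ = begin
    frac (α / M) ℚ.+ frac (β / M) ℚ.+ frac (γ / M)
      ≡⟨ cong₂ ℚ._+_ (cong₂ ℚ._+_ (frac-/ α M) (frac-/ β M)) (frac-/ γ M) ⟩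
    + A / M ℚ.+ + B / M ℚ.+ + C / M
      ≡⟨ trans (cong (ℚ._+ + C / M) (/-+-/-same (+ A) (+ B) M)) (/-+-/-same (+ A ℤ.+ + B) (+ C) M) ⟩
    (+ A ℤ.+ + B ℤ.+ + C) / M
      ≡⟨ cong (_/ M) (sym (trans (ℤP.pos-+ (A ℕ.+ B) C) (cong (ℤ._+ + C) (ℤP.pos-+ A B)))) ⟩
    + (A ℕ.+ B ℕ.+ C) / M ∎
    where
    open ≡-Reasoning
    A = α ℤ.%ℕ M
    B = β ℤ.%ℕ M
    C = γ ℤ.%ℕ M

  threeTerm : (M : ℕ) .{{_ : NonZero M}} → ℤ → ℤ → ℤ → ℚ
  threeTerm M α β γ =
    P₁ (α / M) ℚ.* P₁ (β / M) ℚ.+ P₁ (β / M) ℚ.* P₁ (γ / M) ℚ.+ P₁ (γ / M) ℚ.* P₁ (α / M)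
    ℚ.+ (P₂ (α / M) ℚ.+ P₂ (β / M) ℚ.+ P₂ (γ / M))

  module _ where
    open import Data.Rational.Solver
    open +-*-Solver

    private
      ½[s-1][s-2] : ℚ → ℚ
      ½[s-1][s-2] s = ℚ.½ ℚ.* (s ℚ.- ℚ.1ℚ) ℚ.* (s ℚ.- + 2 / 1)

      threeTerm-polynomial : ∀ x y z →
        bern₁ x ℚ.* bern₁ y ℚ.+ bern₁ y ℚ.* bern₁ z ℚ.+ bern₁ z ℚ.* bern₁ x
        ℚ.+ (bern₂ x ℚ.* (+ 1 / 2) ℚ.+ bern₂ y ℚ.* (+ 1 / 2) ℚ.+ bern₂ z ℚ.* (+ 1 / 2))
        ≡ ½[s-1][s-2] (x ℚ.+ y ℚ.+ z)
      threeTerm-polynomial = solve 3 (λ x y z →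
        (x :- h) :* (y :- h) :+ (y :- h) :* (z :- h) :+ (z :- h) :* (x :- h)
        :+ (b₂ x :* con (+ 1 / 2) :+ b₂ y :* con (+ 1 / 2) :+ b₂ z :* con (+ 1 / 2))
        := con ℚ.½ :* ((x :+ y :+ z) :- con ℚ.1ℚ) :* ((x :+ y :+ z) :- con (+ 2 / 1))) refl
        where h = con ℚ.½
              b₂ = λ x → x :* x :- x :+ con (+ 1 / 6)

    threeTerm-vanishes : ∀ M .{{_ : NonZero M}} α β γ → α ℤ.+ β ℤ.+ γ ≡ + 0 →
                         (α ℤ.%ℕ M ≡ 0 × β ℤ.%ℕ M ≡ 0) ⊎ threeTerm M α β γ ≡ ℚ.0ℚ
    threeTerm-vanishes M@(suc _) α β γ α+β+γ≡0 = by-count (proj₁ multiple) (proj₂ multiple)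
      where
      A = α ℤ.%ℕ M
      B = β ℤ.%ℕ M
      C = γ ℤ.%ℕ M
      multiple = residues-sum-to-multiple M α β γ α+β+γ≡0
      ABC<3M : A ℕ.+ B ℕ.+ C ℕ.< 3 ℕ.* M
      ABC<3M = subst (A ℕ.+ B ℕ.+ C ℕ.<_) (trans (ℕP.+-assoc M M M) (cong (M ℕ.+_) (cong (M ℕ.+_) (sym (ℕP.+-identityʳ M)))))
                 (ℕP.+-mono-< (ℕP.+-mono-< (n%ℕd<d α M) (n%ℕd<d β M)) (n%ℕd<d γ M))
      value : ∀ {t} → A ℕ.+ B ℕ.+ C ≡ t ℕ.* M → threeTerm M α β γ ≡ ½[s-1][s-2] (+ t / 1)
      value {t} e = trans (threeTerm-polynomial (frac (α / M)) (frac (β / M)) (frac (γ / M)))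
        (cong ½[s-1][s-2] (trans (frac-/-sum M α β γ) (cross-multiply (+ (A ℕ.+ B ℕ.+ C)) (+ t) M 1
          (trans (cong (λ n → + n ℤ.* + 1) e) (trans (cong (ℤ._* + 1) (ℤP.pos-* t M)) (ℤP.*-identityʳ _))))))
      by-count : ∀ t → A ℕ.+ B ℕ.+ C ≡ t ℕ.* M → (A ≡ 0 × B ≡ 0) ⊎ threeTerm M α β γ ≡ ℚ.0ℚ
      by-count 0 e = inj₁ (ℕP.m+n≡0⇒m≡0 A A+B≡0 , ℕP.m+n≡0⇒n≡0 A A+B≡0)
        where A+B≡0 = ℕP.m+n≡0⇒m≡0 (A ℕ.+ B) e
      by-count 1 e = inj₂ (value {1} e)
      by-count 2 e = inj₂ (value {2} e)
      by-count (suc (suc (suc t))) e =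
        ⊥-elim (ℕP.<⇒≱ ABC<3M (subst (3 ℕ.* M ℕ.≤_) (sym e) (ℕP.*-monoˡ-≤ M (ℕP.m≤m+n 3 t))))

  threeTerm-0 : ∀ M .{{_ : NonZero M}} → threeTerm M (+ 0) (+ 0) (+ 0) ≡ ℚ.1ℚ
  threeTerm-0 M = cong (λ x → P₁ x ℚ.* P₁ x ℚ.+ P₁ x ℚ.* P₁ x ℚ.+ P₁ x ℚ.* P₁ x ℚ.+ (P₂ x ℚ.+ P₂ x ℚ.+ P₂ x))
                       (ℚP.0/n≡0 M)

-- Finite sums and periodic sequences

module Sums {c ℓ} (R : CommutativeRing c ℓ) (ι : ℚ → CommutativeRing.Carrier R) where
  open CommutativeRing R
  open WithRing R ι using (Σ<; Σ₁; Periodic)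
  open import Relation.Binary.Reasoning.Setoid setoid
  open import Algebra.Properties.CommutativeSemigroup +-commutativeSemigroup using (interchange)
  open import Algebra.Properties.AbelianGroup +-abelianGroup using (∙-cancelʳ)
  import Algebra.Properties.CommutativeMonoid.Sum +-commutativeMonoid as Fin-Σ

  Σ-cong : ∀ n {h g : ℕ → Carrier} → (∀ i → i ℕ.< n → h i ≈ g i) → Σ< n h ≈ Σ< n g
  Σ-cong zero    e = refl
  Σ-cong (suc n) e = +-cong (Σ-cong n (λ i i<n → e i (ℕP.m<n⇒m<1+n i<n))) (e n ℕP.≤-refl)

  Σ-cong′ : ∀ n {h g : ℕ → Carrier} → (∀ i → h i ≈ g i) → Σ< n h ≈ Σ< n g
  Σ-cong′ n e = Σ-cong n (λ i _ → e i)

  Σ-zero : ∀ n → Σ< n (λ _ → 0#) ≈ 0#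
  Σ-zero zero    = refl
  Σ-zero (suc n) = trans (+-identityʳ _) (Σ-zero n)

  Σ-distrib-+ : ∀ n (h g : ℕ → Carrier) → Σ< n (λ i → h i + g i) ≈ Σ< n h + Σ< n g
  Σ-distrib-+ zero    h g = sym (+-identityʳ 0#)
  Σ-distrib-+ (suc n) h g = trans (+-congʳ (Σ-distrib-+ n h g)) (interchange _ _ _ _)

  *-distribˡ-Σ : ∀ n a (h : ℕ → Carrier) → a * Σ< n h ≈ Σ< n (λ i → a * h i)
  *-distribˡ-Σ zero    a h = zeroʳ a
  *-distribˡ-Σ (suc n) a h = trans (distribˡ a _ _) (+-congʳ (*-distribˡ-Σ n a h))

  *-distribʳ-Σ : ∀ n a (h : ℕ → Carrier) → Σ< n h * a ≈ Σ< n (λ i → h i * a)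
  *-distribʳ-Σ n a h = trans (*-comm _ a) (trans (*-distribˡ-Σ n a h) (Σ-cong′ n (λ i → *-comm a (h i))))

  Σ-comm : ∀ n m (h : ℕ → ℕ → Carrier) →
           Σ< n (λ i → Σ< m (λ j → h i j)) ≈ Σ< m (λ j → Σ< n (λ i → h i j))
  Σ-comm zero    m h = sym (Σ-zero m)
  Σ-comm (suc n) m h = trans (+-congʳ (Σ-comm n m h)) (sym (Σ-distrib-+ m _ _))

  Σ-split : ∀ m n (h : ℕ → Carrier) → Σ< (m ℕ.+ n) h ≈ Σ< m h + Σ< n (λ i → h (m ℕ.+ i))
  Σ-split m zero    h = ≡.subst (λ z → Σ< z h ≈ Σ< m h + 0#) (≡.sym (ℕP.+-identityʳ m)) (sym (+-identityʳ _))
  Σ-split m (suc n) h = ≡.subst (λ z → Σ< z h ≈ Σ< m h + Σ< (suc n) (λ i → h (m ℕ.+ i))) (≡.sym (ℕP.+-suc m n))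
    (trans (+-congʳ (Σ-split m n h)) (+-assoc _ _ _))

  Σ-rows : ∀ a k (h : ℕ → Carrier) → Σ< (a ℕ.* k) h ≈ Σ< a (λ q → Σ< k (λ j → h (q ℕ.* k ℕ.+ j)))
  Σ-rows zero    k h = refl
  Σ-rows (suc a) k h = ≡.subst (λ z → Σ< z h ≈ Σ< (suc a) (λ q → Σ< k (λ j → h (q ℕ.* k ℕ.+ j))))
    (ℕP.+-comm (a ℕ.* k) k) (trans (Σ-split (a ℕ.* k) k h) (+-congʳ (Σ-rows a k h)))

  Σ-head : ∀ n (h : ℕ → Carrier) → Σ< (suc n) h ≈ h 0 + Σ< n (λ i → h (suc i))
  Σ-head zero    h = trans (+-identityˡ _) (sym (+-identityʳ _))
  Σ-head (suc n) h = trans (+-congʳ (Σ-head n h)) (+-assoc _ _ _)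

  Σ₁≈Σ< : ∀ n (h : ℕ → Carrier) → h n ≈ h 0 → Σ₁ n h ≈ Σ< n h
  Σ₁≈Σ< n h hn≈h0 = ∙-cancelʳ (h 0) _ _ (begin
    Σ< n (λ i → h (suc i)) + h 0 ≈⟨ +-comm _ _ ⟩
    h 0 + Σ< n (λ i → h (suc i)) ≈⟨ Σ-head n h ⟨
    Σ< n h + h n                 ≈⟨ +-congˡ hn≈h0 ⟩
    Σ< n h + h 0                 ∎)

  Σ-only-0 : ∀ n .{{_ : NonZero n}} (h : ℕ → Carrier) → (∀ i → i ℕ.< n → ¬ i ≡ 0 → h i ≈ 0#) → Σ< n h ≈ h 0
  Σ-only-0 (suc n) h h≈0 = trans (Σ-head n h) (trans (+-congˡ (trans (Σ-cong n (λ i i<n → h≈0 (suc i) (ℕ.s≤s i<n) (λ ())))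
                                                                    (Σ-zero n)))
                                                      (+-identityʳ _))

  Σ≈Fin-Σ : ∀ n (h : ℕ → Carrier) → Σ< n h ≈ Fin-Σ.sum (λ (i : Fin n) → h (toℕ i))
  Σ≈Fin-Σ zero    h = refl
  Σ≈Fin-Σ (suc n) h = trans (Σ-head n h) (+-congˡ (Σ≈Fin-Σ n (λ i → h (suc i))))

  Σ-permute : ∀ N (σ τ : ℕ → ℕ) → (∀ i → i ℕ.< N → σ i ℕ.< N) → (∀ i → i ℕ.< N → τ i ℕ.< N) →
              (∀ i → i ℕ.< N → τ (σ i) ≡ i) → (∀ i → i ℕ.< N → σ (τ i) ≡ i) →
              (h : ℕ → Carrier) → Σ< N (λ i → h (σ i)) ≈ Σ< N h
  Σ-permute N σ τ σ< τ< τσ στ h = begin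
    Σ< N (λ i → h (σ i))                        ≈⟨ Σ≈Fin-Σ N _ ⟩
    Fin-Σ.sum {N} (λ i → h (σ (toℕ i)))         ≈⟨ Fin-Σ.sum-cong-≋ {N} {λ i → h (σ (toℕ i))} {λ i → h (toℕ (σF i))}
                                                     (λ i → reflexive (≡.cong h (≡.sym (FinP.toℕ-fromℕ< _)))) ⟩
    Fin-Σ.sum {N} (λ i → h (toℕ (σF i)))        ≈⟨ Fin-Σ.∑-permute (λ i → h (toℕ i)) π ⟨
    Fin-Σ.sum {N} (λ i → h (toℕ i))             ≈⟨ Σ≈Fin-Σ N h ⟨
    Σ< N h                                      ∎
    where
    σF τF : Fin N → Fin N
    σF i = fromℕ< (σ< (toℕ i) (FinP.toℕ<n i))
    τF i = fromℕ< (τ< (toℕ i) (FinP.toℕ<n i))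
    inverse : ∀ (f g : ℕ → ℕ) f< g< → (∀ i → i ℕ.< N → f (g i) ≡ i) → ∀ i →
              fromℕ< (f< (toℕ (fromℕ< (g< (toℕ i) (FinP.toℕ<n i)))) (FinP.toℕ<n _)) ≡ i
    inverse f g f< g< fg i = FinP.toℕ-injective (≡.trans (FinP.toℕ-fromℕ< _)
      (≡.trans (≡.cong f (FinP.toℕ-fromℕ< _)) (fg (toℕ i) (FinP.toℕ<n i))))
    π = permutation σF τF (inverse σ τ σ< τ< στ) (inverse τ σ τ< σ< τσ)

  private
    periodic-multiple⁺ : ∀ {N H} → Periodic N H → ∀ z n → H (z ℤ.+ + n ℤ.* + N) ≈ H z
    periodic-multiple⁺ {N} {H} p z zero    = reflexive (≡.cong H (ℤP.+-identityʳ z))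
    periodic-multiple⁺ {N} {H} p z (suc n) = trans (reflexive (≡.cong H (lemma z (+ n) (+ N))))
                                                    (trans (p _) (periodic-multiple⁺ p z n))
      where lemma : ∀ z n N → z ℤ.+ (+ 1 ℤ.+ n) ℤ.* N ≡ (z ℤ.+ n ℤ.* N) ℤ.+ N
            lemma = solve-∀

  periodic-multiple : ∀ {N H} → Periodic N H → ∀ z t → H (z ℤ.+ t ℤ.* + N) ≈ H z
  periodic-multiple p z (+ n)            = periodic-multiple⁺ p z n
  periodic-multiple {N} {H} p z -[1+ n ] = sym (trans (reflexive (≡.cong H (lemma z -[1+ n ] (+ N))))
                                                      (periodic-multiple⁺ p _ (suc n)))
    where lemma : ∀ z t N → z ≡ (z ℤ.+ t ℤ.* N) ℤ.+ (ℤ.- t) ℤ.* N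
          lemma = solve-∀

  periodic-residue : ∀ {N H} .{{_ : NonZero N}} → Periodic N H → ∀ z → H z ≈ H (+ (z ℤ.%ℕ N))
  periodic-residue {N} {H} p z = sym (trans (reflexive (≡.cong H (+[a%ℕN]≡a-[a/ℕN]*N z N)))
                                            (periodic-multiple p z (ℤ.- (z ℤ./ℕ N))))

  private
    affine-left-inverse : ∀ u v s t N x m → v ℤ.* u ≡ + 1 ℤ.+ t ℤ.* N →
                          v ℤ.* ((u ℤ.* x ℤ.+ s ℤ.+ m ℤ.* N) ℤ.- s) ≡ x ℤ.+ (t ℤ.* x ℤ.+ v ℤ.* m) ℤ.* N
    affine-left-inverse u v s t N x m vu≡ = ≡.trans (expand u v s x m N)
      (≡.trans (≡.cong (λ w → w ℤ.* x ℤ.+ (v ℤ.* m) ℤ.* N) vu≡) (collect t x v m N))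
      where expand : ∀ u v s x m N → v ℤ.* ((u ℤ.* x ℤ.+ s ℤ.+ m ℤ.* N) ℤ.- s) ≡ (v ℤ.* u) ℤ.* x ℤ.+ (v ℤ.* m) ℤ.* N
            expand = solve-∀
            collect : ∀ t x v m N → (+ 1 ℤ.+ t ℤ.* N) ℤ.* x ℤ.+ (v ℤ.* m) ℤ.* N ≡ x ℤ.+ (t ℤ.* x ℤ.+ v ℤ.* m) ℤ.* N
            collect = solve-∀

    affine-right-inverse : ∀ u v s t N x m → v ℤ.* u ≡ + 1 ℤ.+ t ℤ.* N →
                           u ℤ.* (v ℤ.* (x ℤ.- s) ℤ.+ m ℤ.* N) ℤ.+ s ≡ x ℤ.+ (t ℤ.* (x ℤ.- s) ℤ.+ u ℤ.* m) ℤ.* N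
    affine-right-inverse u v s t N x m vu≡ = ≡.trans (expand u v s x m N)
      (≡.trans (≡.cong (λ w → w ℤ.* (x ℤ.- s) ℤ.+ s ℤ.+ (u ℤ.* m) ℤ.* N) vu≡) (collect t x s u m N))
      where expand : ∀ u v s x m N → u ℤ.* (v ℤ.* (x ℤ.- s) ℤ.+ m ℤ.* N) ℤ.+ s ≡ (v ℤ.* u) ℤ.* (x ℤ.- s) ℤ.+ s ℤ.+ (u ℤ.* m) ℤ.* N
            expand = solve-∀
            collect : ∀ t x s u m N → (+ 1 ℤ.+ t ℤ.* N) ℤ.* (x ℤ.- s) ℤ.+ s ℤ.+ (u ℤ.* m) ℤ.* N ≡ x ℤ.+ (t ℤ.* (x ℤ.- s) ℤ.+ u ℤ.* m) ℤ.* N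
            collect = solve-∀

  Σ-periodic-affine : ∀ N .{{_ : NonZero N}} {H : ℤ → Carrier} → Periodic N H → ∀ u v s t →
                      v ℤ.* u ≡ + 1 ℤ.+ t ℤ.* + N →
                      Σ< N (λ j → H (u ℤ.* + j ℤ.+ s)) ≈ Σ< N (λ j → H (+ j))
  Σ-periodic-affine N {H} p u v s t vu≡ = trans (Σ-cong′ N (λ j → periodic-residue p (u ℤ.* + j ℤ.+ s)))
    (Σ-permute N σ τ (λ j _ → n%ℕd<d (u ℤ.* + j ℤ.+ s) N) (λ i _ → n%ℕd<d (v ℤ.* (+ i ℤ.- s)) N) τσ στ (λ i → H (+ i)))
    where
    σ τ : ℕ → ℕ
    σ j = (u ℤ.* + j ℤ.+ s) ℤ.%ℕ N
    τ i = (v ℤ.* (+ i ℤ.- s)) ℤ.%ℕ N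
    τσ : ∀ j → j ℕ.< N → τ (σ j) ≡ j
    τσ j j<N = ≡.trans (≡.cong (λ x → (v ℤ.* (x ℤ.- s)) ℤ.%ℕ N) (+[a%ℕN]≡a-[a/ℕN]*N (u ℤ.* + j ℤ.+ s) N))
      (≡.trans (≡.cong (ℤ._%ℕ N) (affine-left-inverse u v s t (+ N) (+ j) m vu≡))
        (≡.trans ([a+tN]%ℕN≡a%ℕN (+ j) (t ℤ.* + j ℤ.+ v ℤ.* m) N) (n<N⇒+n%ℕN≡n j<N)))
      where m = ℤ.- ((u ℤ.* + j ℤ.+ s) ℤ./ℕ N)
    στ : ∀ i → i ℕ.< N → σ (τ i) ≡ i
    στ i i<N = ≡.trans (≡.cong (λ x → (u ℤ.* x ℤ.+ s) ℤ.%ℕ N) (+[a%ℕN]≡a-[a/ℕN]*N (v ℤ.* (+ i ℤ.- s)) N))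
      (≡.trans (≡.cong (ℤ._%ℕ N) (affine-right-inverse u v s t (+ N) (+ i) m vu≡))
        (≡.trans ([a+tN]%ℕN≡a%ℕN (+ i) (t ℤ.* (+ i ℤ.- s) ℤ.+ u ℤ.* m) N) (n<N⇒+n%ℕN≡n i<N)))
      where m = ℤ.- ((v ℤ.* (+ i ℤ.- s)) ℤ./ℕ N)

  Σ-periodic-reflect : ∀ N .{{_ : NonZero N}} {H : ℤ → Carrier} → Periodic N H →
                       Σ< N (λ j → H (ℤ.- + j)) ≈ Σ< N (λ j → H (+ j))
  Σ-periodic-reflect N {H} p = trans (Σ-cong′ N (λ j → reflexive (≡.cong H (lemma (+ j)))))
                                     (Σ-periodic-affine N p (ℤ.- + 1) (ℤ.- + 1) (+ 0) (+ 0) ≡.refl)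
    where lemma : ∀ j → ℤ.- j ≡ ℤ.- + 1 ℤ.* j ℤ.+ + 0
          lemma = solve-∀

  Σ-periodic-rows : ∀ a k {W : ℤ → Carrier} → Periodic k W → (h : ℕ → Carrier) →
                    Σ< (a ℕ.* k) (λ n → W (+ n) * h n) ≈ Σ< k (λ j → W (+ j) * Σ< a (λ q → h (q ℕ.* k ℕ.+ j)))
  Σ-periodic-rows a k {W} p h = begin
    Σ< (a ℕ.* k) (λ n → W (+ n) * h n)                         ≈⟨ Σ-rows a k _ ⟩
    Σ< a (λ q → Σ< k (λ j → W (+ (q ℕ.* k ℕ.+ j)) * h (q ℕ.* k ℕ.+ j)))
      ≈⟨ Σ-cong′ a (λ q → Σ-cong′ k (λ j → *-congʳ (trans (reflexive (≡.cong W (row-entry q j))) (periodic-multiple p (+ j) (+ q))))) ⟩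
    Σ< a (λ q → Σ< k (λ j → W (+ j) * h (q ℕ.* k ℕ.+ j)))      ≈⟨ Σ-comm a k _ ⟩
    Σ< k (λ j → Σ< a (λ q → W (+ j) * h (q ℕ.* k ℕ.+ j)))      ≈⟨ Σ-cong′ k (λ j → *-distribˡ-Σ a (W (+ j)) (λ q → h (q ℕ.* k ℕ.+ j))) ⟨
    Σ< k (λ j → W (+ j) * Σ< a (λ q → h (q ℕ.* k ℕ.+ j)))      ∎
    where
    row-entry : ∀ q j → + (q ℕ.* k ℕ.+ j) ≡ + j ℤ.+ + q ℤ.* + k
    row-entry q j = ≡.trans (ℤP.pos-+ (q ℕ.* k) j) (≡.trans (≡.cong (ℤ._+ + j) (ℤP.pos-* q k)) (ℤP.+-comm (+ q ℤ.* + k) (+ j)))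

  dil-periodic : ∀ {k g} γ → Periodic k g → Periodic k (WithRing.dil R ι γ g)
  dil-periodic {k} {g} γ p z = trans (reflexive (≡.cong g (ℤP.*-distribˡ-+ γ z (+ k)))) (periodic-multiple p (γ ℤ.* z) γ)

  Σ-*-Σ : ∀ n m (h : ℕ → Carrier) (g : ℕ → Carrier) →
          Σ< n (λ i → Σ< m (λ j → h i * g j)) ≈ Σ< n h * Σ< m g
  Σ-*-Σ n m h g = trans (Σ-cong′ n (λ i → sym (*-distribˡ-Σ m (h i) g))) (sym (*-distribʳ-Σ n (Σ< m g) h))

-- Raabe's relations for P₁ and P₂

module _ where
  open ≡

  private
    ℚ-ring = ℚP.+-*-commutativeRing
    open WithRing ℚ-ring (λ x → x) using (Σ<; Periodic)
    open Sums ℚ-ring (λ x → x) using (Σ-cong; Σ-cong′; *-distribʳ-Σ; Σ-periodic-affine)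

  ℕ→ℚ-suc : ∀ n → ℕ→ℚ (suc n) ≡ ℕ→ℚ n ℚ.+ ℚ.1ℚ
  ℕ→ℚ-suc n = sym (trans (/-+-/-same (+ n) (+ 1) 1)
    (cong (_/ 1) (trans (sym (ℤP.pos-+ n 1)) (cong +_ (ℕP.+-comm n 1)))))

  ℕ→ℚ[n]*[1/n]≡1 : ∀ n .{{_ : NonZero n}} → ℕ→ℚ n ℚ.* (+ 1 / n) ≡ ℚ.1ℚ
  ℕ→ℚ[n]*[1/n]≡1 n = trans (/-*-/ (+ n) (+ 1) 1 n)
    (cross-multiply (+ n ℤ.* + 1) (+ 1) (1 ℕ.* n) 1 {{m*n≢0 1 n}} (trans (lemma (+ n)) (cong (+ 1 ℤ.*_) (sym (ℤP.pos-* 1 n)))))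
    where lemma : ∀ n → (n ℤ.* + 1) ℤ.* + 1 ≡ + 1 ℤ.* (+ 1 ℤ.* n)
          lemma = solve-∀

  module _ where
    open import Data.Rational.Solver
    open +-*-Solver

    quadratic-sum : ℚ → ℚ → ℚ → ℚ → ℚ
    quadratic-sum n α β γ = n ℚ.* α ℚ.+ n ℚ.* (n ℚ.- ℚ.1ℚ) ℚ.* ℚ.½ ℚ.* β
                            ℚ.+ n ℚ.* (n ℚ.- ℚ.1ℚ) ℚ.* (+ 2 / 1 ℚ.* n ℚ.- ℚ.1ℚ) ℚ.* (+ 1 / 6) ℚ.* γ

    private
      quadratic-sum-syntax : ∀ {m} → Polynomial m → Polynomial m → Polynomial m → Polynomial m → Polynomial m
      quadratic-sum-syntax n α β γ = n :* α :+ n :* (n :- con ℚ.1ℚ) :* con ℚ.½ :* β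
        :+ n :* (n :- con ℚ.1ℚ) :* (con (+ 2 / 1) :* n :- con ℚ.1ℚ) :* con (+ 1 / 6) :* γ

      quadratic-sum-step : ∀ n α β γ → quadratic-sum n α β γ ℚ.+ (α ℚ.+ n ℚ.* β ℚ.+ (n ℚ.* n) ℚ.* γ)
                                       ≡ quadratic-sum (n ℚ.+ ℚ.1ℚ) α β γ
      quadratic-sum-step = solve 4 (λ n α β γ → quadratic-sum-syntax n α β γ :+ (α :+ n :* β :+ (n :* n) :* γ)
                                                := quadratic-sum-syntax (n :+ con ℚ.1ℚ) α β γ) refl

    Σ-quadratic : ∀ d α β γ → Σ< d (λ q → α ℚ.+ ℕ→ℚ q ℚ.* β ℚ.+ (ℕ→ℚ q ℚ.* ℕ→ℚ q) ℚ.* γ)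
                              ≡ quadratic-sum (ℕ→ℚ d) α β γ
    Σ-quadratic zero = solve 3 (λ α β γ → con ℚ.0ℚ := quadratic-sum-syntax (con ℚ.0ℚ) α β γ) refl
    Σ-quadratic (suc d) α β γ =
      trans (cong (ℚ._+ (α ℚ.+ ℕ→ℚ d ℚ.* β ℚ.+ (ℕ→ℚ d ℚ.* ℕ→ℚ d) ℚ.* γ)) (Σ-quadratic d α β γ))
            (trans (quadratic-sum-step (ℕ→ℚ d) α β γ) (cong (λ n → quadratic-sum n α β γ) (sym (ℕ→ℚ-suc d))))

    private
      vanish : ∀ y Q → y ℚ.+ (ℚ.1ℚ ℚ.- ℚ.1ℚ) ℚ.* Q ≡ y
      vanish = solve 2 (λ y Q → y :+ (con ℚ.1ℚ :- con ℚ.1ℚ) :* Q := y) refl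

    -- Both sides agree modulo n v − 1; the cofactors were found by dividing their difference by n v − 1.
    raabe₁ : ∀ d x v → ℕ→ℚ d ℚ.* v ≡ ℚ.1ℚ → Σ< d (λ q → bern₁ ((x ℚ.+ ℕ→ℚ q) ℚ.* v)) ≡ bern₁ x
    raabe₁ d x v nv≡1 = begin
      Σ< d (λ q → bern₁ ((x ℚ.+ ℕ→ℚ q) ℚ.* v))
        ≡⟨ Σ-cong′ d (λ q → expand x v (ℕ→ℚ q)) ⟩
      Σ< d (λ q → (x ℚ.* v ℚ.- ℚ.½) ℚ.+ ℕ→ℚ q ℚ.* v ℚ.+ (ℕ→ℚ q ℚ.* ℕ→ℚ q) ℚ.* ℚ.0ℚ)
        ≡⟨ Σ-quadratic d _ v ℚ.0ℚ ⟩
      quadratic-sum n (x ℚ.* v ℚ.- ℚ.½) v ℚ.0ℚ  ≡⟨ cofactor n x v ⟩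
      bern₁ x ℚ.+ (n ℚ.* v ℚ.- ℚ.1ℚ) ℚ.* Q      ≡⟨ cong (λ w → bern₁ x ℚ.+ (w ℚ.- ℚ.1ℚ) ℚ.* Q) nv≡1 ⟩
      bern₁ x ℚ.+ (ℚ.1ℚ ℚ.- ℚ.1ℚ) ℚ.* Q         ≡⟨ vanish (bern₁ x) Q ⟩
      bern₁ x                                   ∎
      where
      open ≡-Reasoning
      n = ℕ→ℚ d
      Q = x ℚ.+ ℚ.½ ℚ.* n ℚ.- ℚ.½
      expand : ∀ x v q → bern₁ ((x ℚ.+ q) ℚ.* v) ≡ (x ℚ.* v ℚ.- ℚ.½) ℚ.+ q ℚ.* v ℚ.+ (q ℚ.* q) ℚ.* ℚ.0ℚ
      expand = solve 3 (λ x v q → (x :+ q) :* v :- con ℚ.½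
                                  := (x :* v :- con ℚ.½) :+ q :* v :+ (q :* q) :* con ℚ.0ℚ) refl
      cofactor : ∀ n x v → quadratic-sum n (x ℚ.* v ℚ.- ℚ.½) v ℚ.0ℚ
                           ≡ bern₁ x ℚ.+ (n ℚ.* v ℚ.- ℚ.1ℚ) ℚ.* (x ℚ.+ ℚ.½ ℚ.* n ℚ.- ℚ.½)
      cofactor = solve 3 (λ n x v → quadratic-sum-syntax n (x :* v :- con ℚ.½) v (con ℚ.0ℚ)
                                    := (x :- con ℚ.½) :+ (n :* v :- con ℚ.1ℚ) :* (x :+ con ℚ.½ :* n :- con ℚ.½)) refl

    raabe₂ : ∀ d x v → ℕ→ℚ d ℚ.* v ≡ ℚ.1ℚ → Σ< d (λ q → bern₂ ((x ℚ.+ ℕ→ℚ q) ℚ.* v)) ≡ v ℚ.* bern₂ x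
    raabe₂ d x v nv≡1 = begin
      Σ< d (λ q → bern₂ ((x ℚ.+ ℕ→ℚ q) ℚ.* v))
        ≡⟨ Σ-cong′ d (λ q → expand x v (ℕ→ℚ q)) ⟩
      Σ< d (λ q → α ℚ.+ ℕ→ℚ q ℚ.* β ℚ.+ (ℕ→ℚ q ℚ.* ℕ→ℚ q) ℚ.* (v ℚ.* v))
        ≡⟨ Σ-quadratic d α β (v ℚ.* v) ⟩
      quadratic-sum n α β (v ℚ.* v)            ≡⟨ cofactor n x v ⟩
      v ℚ.* bern₂ x ℚ.+ (n ℚ.* v ℚ.- ℚ.1ℚ) ℚ.* Q ≡⟨ cong (λ w → v ℚ.* bern₂ x ℚ.+ (w ℚ.- ℚ.1ℚ) ℚ.* Q) nv≡1 ⟩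
      v ℚ.* bern₂ x ℚ.+ (ℚ.1ℚ ℚ.- ℚ.1ℚ) ℚ.* Q  ≡⟨ vanish (v ℚ.* bern₂ x) Q ⟩
      v ℚ.* bern₂ x                            ∎
      where
      open ≡-Reasoning
      n = ℕ→ℚ d
      α = x ℚ.* x ℚ.* (v ℚ.* v) ℚ.- x ℚ.* v ℚ.+ + 1 / 6
      β = + 2 / 1 ℚ.* x ℚ.* (v ℚ.* v) ℚ.- v
      Q = + 1 / 3 ℚ.* n ℚ.* n ℚ.* v ℚ.+ n ℚ.* v ℚ.* x ℚ.- ℚ.½ ℚ.* n ℚ.* v ℚ.- + 1 / 6 ℚ.* n
          ℚ.+ v ℚ.* x ℚ.* x ℚ.- v ℚ.* x ℚ.+ + 1 / 6 ℚ.* v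
      b₂ : ∀ {m} → Polynomial m → Polynomial m
      b₂ y = y :* y :- y :+ con (+ 1 / 6)
      expand : ∀ x v q → bern₂ ((x ℚ.+ q) ℚ.* v) ≡ (x ℚ.* x ℚ.* (v ℚ.* v) ℚ.- x ℚ.* v ℚ.+ + 1 / 6)
                          ℚ.+ q ℚ.* (+ 2 / 1 ℚ.* x ℚ.* (v ℚ.* v) ℚ.- v) ℚ.+ (q ℚ.* q) ℚ.* (v ℚ.* v)
      expand = solve 3 (λ x v q → b₂ ((x :+ q) :* v)
        := (x :* x :* (v :* v) :- x :* v :+ con (+ 1 / 6)) :+ q :* (con (+ 2 / 1) :* x :* (v :* v) :- v)
           :+ (q :* q) :* (v :* v)) refl
      cofactor : ∀ n x v → quadratic-sum n (x ℚ.* x ℚ.* (v ℚ.* v) ℚ.- x ℚ.* v ℚ.+ + 1 / 6)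
                                           (+ 2 / 1 ℚ.* x ℚ.* (v ℚ.* v) ℚ.- v) (v ℚ.* v)
        ≡ v ℚ.* bern₂ x ℚ.+ (n ℚ.* v ℚ.- ℚ.1ℚ) ℚ.* (+ 1 / 3 ℚ.* n ℚ.* n ℚ.* v ℚ.+ n ℚ.* v ℚ.* x ℚ.- ℚ.½ ℚ.* n ℚ.* v
                                                     ℚ.- + 1 / 6 ℚ.* n ℚ.+ v ℚ.* x ℚ.* x ℚ.- v ℚ.* x ℚ.+ + 1 / 6 ℚ.* v)
      cofactor = solve 3 (λ n x v →
        quadratic-sum-syntax n (x :* x :* (v :* v) :- x :* v :+ con (+ 1 / 6)) (con (+ 2 / 1) :* x :* (v :* v) :- v) (v :* v)
        := v :* b₂ x :+ (n :* v :- con ℚ.1ℚ) :* (con (+ 1 / 3) :* n :* n :* v :+ n :* v :* x :- con ℚ.½ :* n :* v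
                                               :- con (+ 1 / 6) :* n :+ v :* x :* x :- v :* x :+ con (+ 1 / 6) :* v)) refl

  module _ (a N : ℕ) .{{_ : NonZero a}} .{{_ : NonZero N}} where
    private
      aN = a ℕ.* N
      instance
        aN≢0 : NonZero aN
        aN≢0 = m*n≢0 a N

      fraction-split : ∀ r q → (+ r / N ℚ.+ ℕ→ℚ q) ℚ.* (+ 1 / a) ≡ (+ r ℤ.+ + N ℤ.* + q) / aN
      fraction-split r q = begin
        (+ r / N ℚ.+ + q / 1) ℚ.* (+ 1 / a)
          ≡⟨ cong (ℚ._* (+ 1 / a)) (/-+-/ (+ r) (+ q) N 1) ⟩
        _/_ (+ r ℤ.* + 1 ℤ.+ + q ℤ.* + N) (N ℕ.* 1) {{m*n≢0 N 1}} ℚ.* (+ 1 / a)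
          ≡⟨ /-*-/ (+ r ℤ.* + 1 ℤ.+ + q ℤ.* + N) (+ 1) (N ℕ.* 1) a {{m*n≢0 N 1}} ⟩
        _/_ ((+ r ℤ.* + 1 ℤ.+ + q ℤ.* + N) ℤ.* + 1) ((N ℕ.* 1) ℕ.* a) {{m*n≢0 (N ℕ.* 1) a {{m*n≢0 N 1}}}}
          ≡⟨ cross-multiply ((+ r ℤ.* + 1 ℤ.+ + q ℤ.* + N) ℤ.* + 1) (+ r ℤ.+ + N ℤ.* + q) ((N ℕ.* 1) ℕ.* a) aN {{m*n≢0 (N ℕ.* 1) a {{m*n≢0 N 1}}}}
               (trans (cong (((+ r ℤ.* + 1 ℤ.+ + q ℤ.* + N) ℤ.* + 1) ℤ.*_) (ℤP.pos-* a N))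
                 (trans (lemma (+ r) (+ q) (+ N) (+ a))
                   (cong ((+ r ℤ.+ + N ℤ.* + q) ℤ.*_) (sym (trans (ℤP.pos-* (N ℕ.* 1) a) (cong (ℤ._* + a) (ℤP.pos-* N 1))))))) ⟩
        (+ r ℤ.+ + N ℤ.* + q) / aN ∎
        where
        open ≡-Reasoning
        lemma : ∀ r q N a → ((r ℤ.* + 1 ℤ.+ q ℤ.* N) ℤ.* + 1) ℤ.* (a ℤ.* N) ≡ (r ℤ.+ N ℤ.* q) ℤ.* ((N ℤ.* + 1) ℤ.* a)
        lemma = solve-∀

      +r+Nq<aN : ∀ {r q} → r ℕ.< N → q ℕ.< a → r ℕ.+ N ℕ.* q ℕ.< aN
      +r+Nq<aN {r} {q} r<N q<a = ℕP.<-≤-trans (ℕP.+-monoˡ-< (N ℕ.* q) r<N)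
        (subst (N ℕ.+ N ℕ.* q ℕ.≤_) (ℕP.*-comm N a) (subst (ℕ._≤ N ℕ.* a) (ℕP.*-suc N q) (ℕP.*-monoʳ-≤ N q<a)))

    frac-distribution : ∀ (G : ℚ → ℚ) y u v t → v ℤ.* u ≡ + 1 ℤ.+ t ℤ.* + a →
      Σ< a (λ q → G (frac ((y ℤ.+ + N ℤ.* (u ℤ.* + q)) / aN)))
      ≡ Σ< a (λ q → G ((frac (y / N) ℚ.+ ℕ→ℚ q) ℚ.* (+ 1 / a)))
    frac-distribution G y u v t vu≡ = begin
      Σ< a (λ q → G (frac ((y ℤ.+ + N ℤ.* (u ℤ.* + q)) / aN)))
        ≡⟨ Σ-cong′ a (λ q → cong (λ x → G (frac (x / aN))) (regroup (u ℤ.* + q))) ⟩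
      Σ< a (λ q → H (u ℤ.* + q ℤ.+ Q))   ≡⟨ Σ-periodic-affine a H-periodic u v Q t vu≡ ⟩
      Σ< a (λ q → H (+ q))               ≡⟨ Σ-cong a (λ q q<a → H-small q q<a) ⟩
      Σ< a (λ q → G ((frac (y / N) ℚ.+ ℕ→ℚ q) ℚ.* (+ 1 / a))) ∎
      where
      open ≡-Reasoning
      r = y ℤ.%ℕ N
      Q = y ℤ./ℕ N
      H : ℤ → ℚ
      H z = G (frac ((+ r ℤ.+ + N ℤ.* z) / aN))
      H-periodic : Periodic a H
      H-periodic z = cong G (trans (cong (λ x → frac (x / aN)) (trans (lemma (+ r) (+ N) z (+ a))
                                                               (cong (λ w → (+ r ℤ.+ + N ℤ.* z) ℤ.+ + 1 ℤ.* w) (sym (ℤP.pos-* a N)))))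
                                   (frac-periodic (+ r ℤ.+ + N ℤ.* z) (+ 1) aN))
        where lemma : ∀ r N z a → r ℤ.+ N ℤ.* (z ℤ.+ a) ≡ (r ℤ.+ N ℤ.* z) ℤ.+ + 1 ℤ.* (a ℤ.* N)
              lemma = solve-∀
      regroup : ∀ w → y ℤ.+ + N ℤ.* w ≡ + r ℤ.+ + N ℤ.* (w ℤ.+ Q)
      regroup w = trans (cong (ℤ._+ + N ℤ.* w) (a≡a%ℕn+[a/ℕn]*n y N)) (lemma (+ r) Q (+ N) w)
        where lemma : ∀ r Q N w → (r ℤ.+ Q ℤ.* N) ℤ.+ N ℤ.* w ≡ r ℤ.+ N ℤ.* (w ℤ.+ Q)
              lemma = solve-∀
      H-small : ∀ q → q ℕ.< a → H (+ q) ≡ G ((frac (y / N) ℚ.+ ℕ→ℚ q) ℚ.* (+ 1 / a))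
      H-small q q<a = cong G (begin
        frac ((+ r ℤ.+ + N ℤ.* + q) / aN)   ≡⟨ cong (λ x → frac (x / aN)) +r+Nq≡ ⟩
        frac (+ (r ℕ.+ N ℕ.* q) / aN)       ≡⟨ n<N⇒frac[n/N]≡n/N (+r+Nq<aN (n%ℕd<d y N) q<a) ⟩
        + (r ℕ.+ N ℕ.* q) / aN              ≡⟨ cong (_/ aN) (sym +r+Nq≡) ⟩
        (+ r ℤ.+ + N ℤ.* + q) / aN          ≡⟨ fraction-split r q ⟨
        (+ r / N ℚ.+ ℕ→ℚ q) ℚ.* (+ 1 / a)   ≡⟨ cong (λ x → (x ℚ.+ ℕ→ℚ q) ℚ.* (+ 1 / a)) (frac-/ y N) ⟨
        (frac (y / N) ℚ.+ ℕ→ℚ q) ℚ.* (+ 1 / a) ∎)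
        where +r+Nq≡ : + r ℤ.+ + N ℤ.* + q ≡ + (r ℕ.+ N ℕ.* q)
              +r+Nq≡ = sym (trans (ℤP.pos-+ r (N ℕ.* q)) (cong (ℤ._+_ (+ r)) (ℤP.pos-* N q)))

    P₁-distribution : ∀ y u v t → v ℤ.* u ≡ + 1 ℤ.+ t ℤ.* + a →
                      Σ< a (λ q → P₁ ((y ℤ.+ + N ℤ.* (u ℤ.* + q)) / aN)) ≡ P₁ (y / N)
    P₁-distribution y u v t vu≡ = trans (frac-distribution bern₁ y u v t vu≡)
                                        (raabe₁ a (frac (y / N)) (+ 1 / a) (ℕ→ℚ[n]*[1/n]≡1 a))

    P₂-distribution : ∀ y u v t → v ℤ.* u ≡ + 1 ℤ.+ t ℤ.* + a →
                      Σ< a (λ q → P₂ ((y ℤ.+ + N ℤ.* (u ℤ.* + q)) / aN)) ≡ (+ 1 / a) ℚ.* P₂ (y / N)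
    P₂-distribution y u v t vu≡ = begin
      Σ< a (λ q → P₂ ((y ℤ.+ + N ℤ.* (u ℤ.* + q)) / aN))
        ≡⟨ frac-distribution (λ x → bern₂ x ℚ.* (+ 1 / 2)) y u v t vu≡ ⟩
      Σ< a (λ q → bern₂ (x+q/a q) ℚ.* (+ 1 / 2))   ≡⟨ *-distribʳ-Σ a (+ 1 / 2) (λ q → bern₂ (x+q/a q)) ⟨
      Σ< a (λ q → bern₂ (x+q/a q)) ℚ.* (+ 1 / 2)   ≡⟨ cong (ℚ._* (+ 1 / 2)) (raabe₂ a x (+ 1 / a) (ℕ→ℚ[n]*[1/n]≡1 a)) ⟩
      (+ 1 / a) ℚ.* bern₂ x ℚ.* (+ 1 / 2)          ≡⟨ ℚP.*-assoc (+ 1 / a) (bern₂ x) (+ 1 / 2) ⟩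
      (+ 1 / a) ℚ.* P₂ (y / N)                     ∎
      where
      open ≡-Reasoning
      x = frac (y / N)
      x+q/a : ℕ → ℚ
      x+q/a q = (x ℚ.+ ℕ→ℚ q) ℚ.* (+ 1 / a)

  /-cong : ∀ {x y} L L' .{{_ : NonZero L}} .{{_ : NonZero L'}} → x ≡ y → L ≡ L' → x / L ≡ y / L'
  /-cong {x} {y} L L' x≡y L≡L' = cross-multiply x y L L' (trans (cong (λ w → x ℤ.* + w) (sym L≡L')) (cong (ℤ._* + L) x≡y))

  shifted-fraction : ∀ j z y k .{{_ : NonZero y}} .{{_ : NonZero k}} →
                     (ℕ→ℚ j ℚ.+ z / y) ℚ.* (+ 1 / k) ≡ _/_ (+ y ℤ.* + j ℤ.+ z) (y ℕ.* k) {{m*n≢0 y k}}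
  shifted-fraction j z y k = begin
    (+ j / 1 ℚ.+ z / y) ℚ.* (+ 1 / k)
      ≡⟨ cong (ℚ._* (+ 1 / k)) (/-+-/ (+ j) z 1 y) ⟩
    _/_ (+ j ℤ.* + y ℤ.+ z ℤ.* + 1) (1 ℕ.* y) {{m*n≢0 1 y}} ℚ.* (+ 1 / k)
      ≡⟨ /-*-/ (+ j ℤ.* + y ℤ.+ z ℤ.* + 1) (+ 1) (1 ℕ.* y) k {{m*n≢0 1 y}} ⟩
    _/_ ((+ j ℤ.* + y ℤ.+ z ℤ.* + 1) ℤ.* + 1) ((1 ℕ.* y) ℕ.* k) {{m*n≢0 (1 ℕ.* y) k {{m*n≢0 1 y}}}}
      ≡⟨ /-cong ((1 ℕ.* y) ℕ.* k) (y ℕ.* k) {{m*n≢0 (1 ℕ.* y) k {{m*n≢0 1 y}}}} {{m*n≢0 y k}}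
                (lemma (+ j) (+ y) z) (cong (ℕ._* k) (ℕP.*-identityˡ y)) ⟩
    _/_ (+ y ℤ.* + j ℤ.+ z) (y ℕ.* k) {{m*n≢0 y k}} ∎
    where
    open ≡-Reasoning
    lemma : ∀ j y z → (j ℤ.* y ℤ.+ z ℤ.* + 1) ℤ.* + 1 ≡ y ℤ.* j ℤ.+ z
    lemma = solve-∀

  shifted-fraction-0 : ∀ j k .{{_ : NonZero k}} → (ℕ→ℚ j ℚ.+ ℚ.0ℚ) ℚ.* (+ 1 / k) ≡ + j / k
  shifted-fraction-0 j k = trans (cong (ℚ._* (+ 1 / k)) (ℚP.+-identityʳ (ℕ→ℚ j)))
    (trans (/-*-/ (+ j) (+ 1) 1 k) (/-cong (1 ℕ.* k) k {{m*n≢0 1 k}} (ℤP.*-identityʳ (+ j)) (ℕP.*-identityˡ k)))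

  [p*1/k]*k≡p : ∀ p k .{{_ : NonZero k}} → p ℚ.* (+ 1 / k) ℚ.* ℕ→ℚ k ≡ p
  [p*1/k]*k≡p p k = trans (ℚP.*-assoc p (+ 1 / k) (ℕ→ℚ k))
    (trans (cong (p ℚ.*_) (trans (ℚP.*-comm (+ 1 / k) (ℕ→ℚ k)) (ℕ→ℚ[n]*[1/n]≡1 k))) (ℚP.*-identityʳ p))

  x/y≡1/y*x : ∀ x y .{{_ : NonZero y}} → + x / y ≡ (+ 1 / y) ℚ.* ℕ→ℚ x
  x/y≡1/y*x x y = sym (trans (/-*-/ (+ 1) (+ x) y 1) (/-cong (y ℕ.* 1) y {{m*n≢0 y 1}} (ℤP.*-identityˡ (+ x)) (ℕP.*-identityʳ y)))

  1/[2mn]*2≡1/m*1/n : ∀ m n .{{_ : NonZero m}} .{{_ : NonZero n}} →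
                      _/_ (+ 1) (2 ℕ.* (m ℕ.* n)) {{m*n≢0 2 (m ℕ.* n) {{_}} {{m*n≢0 m n}}}} ℚ.* (+ 2 / 1)
                      ≡ (+ 1 / m) ℚ.* (+ 1 / n)
  1/[2mn]*2≡1/m*1/n m n = trans (/-*-/ (+ 1) (+ 2) (2 ℕ.* (m ℕ.* n)) 1 {{m*n≢0 2 (m ℕ.* n) {{_}} {{m*n≢0 m n}}}})
    (trans (cross-multiply (+ 1 ℤ.* + 2) (+ 1 ℤ.* + 1) ((2 ℕ.* (m ℕ.* n)) ℕ.* 1) (m ℕ.* n)
                           {{m*n≢0 (2 ℕ.* (m ℕ.* n)) 1 {{m*n≢0 2 (m ℕ.* n) {{_}} {{m*n≢0 m n}}}}}} {{m*n≢0 m n}}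
             (trans (cong (+ 2 ℤ.*_) (ℤP.pos-* m n))
               (trans (lemma (+ m) (+ n)) (cong (+ 1 ℤ.*_) (sym (trans (ℤP.pos-* (2 ℕ.* (m ℕ.* n)) 1)
                                                         (cong (ℤ._* + 1) (trans (ℤP.pos-* 2 (m ℕ.* n)) (cong (+ 2 ℤ.*_) (ℤP.pos-* m n))))))))))
           (sym (/-*-/ (+ 1) (+ 1) m n)))
    where lemma : ∀ m n → + 2 ℤ.* (m ℤ.* n) ≡ + 1 ℤ.* ((+ 2 ℤ.* (m ℤ.* n)) ℤ.* + 1)
          lemma = solve-∀

-- Sums in a ℚ-algebra

module QAlgebra {c ℓ} (R : CommutativeRing c ℓ) (ι : ℚ → CommutativeRing.Carrier R) (hom : IsQAlgebraMap R ι) where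
  open CommutativeRing R
  open WithRing R ι
  open Sums R ι
  open RingMorphisms.IsRingHomomorphism hom using (+-homo; *-homo; -‿homo; 0#-homo; 1#-homo)
  open import Relation.Binary.Reasoning.Setoid setoid
  open import Algebra.Properties.CommutativeSemigroup +-commutativeSemigroup using () renaming (x∙yz≈y∙xz to +-x∙yz≈y∙xz)
  open import Algebra.Properties.CommutativeSemigroup *-commutativeSemigroup using (x∙yz≈y∙xz)
  private
    module ℚΣ = WithRing ℚP.+-*-commutativeRing (λ x → x)

  ι-cong : ∀ {p q} → p ≡ q → ι p ≈ ι q
  ι-cong p≡q = reflexive (≡.cong ι p≡q)

  ι-Σ : ∀ n (h : ℕ → ℚ) → ι (ℚΣ.Σ< n h) ≈ Σ< n (λ i → ι (h i))
  ι-Σ zero    h = 0#-homo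
  ι-Σ (suc n) h = trans (+-homo _ _) (+-congʳ (ι-Σ n h))

  Σ-const : ∀ n x → Σ< n (λ _ → x) ≈ ι (ℕ→ℚ n) * x
  Σ-const zero    x = sym (trans (*-congʳ 0#-homo) (zeroˡ x))
  Σ-const (suc n) x = begin
    Σ< n (λ _ → x) + x                ≈⟨ +-cong (Σ-const n x) (sym (*-identityˡ x)) ⟩
    ι (ℕ→ℚ n) * x + 1# * x            ≈⟨ distribʳ x _ _ ⟨
    (ι (ℕ→ℚ n) + 1#) * x              ≈⟨ *-congʳ (+-congˡ 1#-homo) ⟨
    (ι (ℕ→ℚ n) + ι ℚ.1ℚ) * x          ≈⟨ *-congʳ (+-homo _ _) ⟨
    ι (ℕ→ℚ n ℚ.+ ℚ.1ℚ) * x            ≈⟨ *-congʳ (ι-cong (ℕ→ℚ-suc n)) ⟨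
    ι (ℕ→ℚ (suc n)) * x               ∎

  Σ-P₁-reflect : ∀ N .{{_ : NonZero N}} (g : ℕ → Carrier) →
                 Σ< N (λ j → g j * ι (P₁ ((ℤ.- + j) / N))) ≈ - Σ< N (λ j → g j * ι (P₁ (+ j / N))) - g 0
  Σ-P₁-reflect N g = begin
    Σ< N (λ j → g j * p₋ j)                                   ≈⟨ +-identityʳ _ ⟨
    Σ< N (λ j → g j * p₋ j) + 0#                              ≈⟨ +-congˡ (-‿inverseˡ (Σ< N (λ j → g j * p₊ j))) ⟨
    Σ< N (λ j → g j * p₋ j) + (- Σ< N (λ j → g j * p₊ j) + Σ< N (λ j → g j * p₊ j))
      ≈⟨ +-x∙yz≈y∙xz _ _ _ ⟩
    - Σ< N (λ j → g j * p₊ j) + (Σ< N (λ j → g j * p₋ j) + Σ< N (λ j → g j * p₊ j))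
      ≈⟨ +-congˡ (trans (sym (Σ-distrib-+ N _ _)) paired) ⟩
    - Σ< N (λ j → g j * p₊ j) - g 0                           ∎
    where
    p₋ p₊ : ℕ → Carrier
    p₋ j = ι (P₁ ((ℤ.- + j) / N))
    p₊ j = ι (P₁ (+ j / N))
    pair : ℕ → Carrier
    pair j = g j * p₋ j + g j * p₊ j
    pair-0 : pair 0 ≈ - g 0
    pair-0 = begin
      g 0 * p₊ 0 + g 0 * p₊ 0          ≈⟨ distribˡ (g 0) _ _ ⟨
      g 0 * (p₊ 0 + p₊ 0)              ≈⟨ *-congˡ (+-homo _ _) ⟨
      g 0 * ι (P₁ (+ 0 / N) ℚ.+ P₁ (+ 0 / N))
        ≈⟨ *-congˡ (trans (ι-cong (≡.cong₂ ℚ._+_ (P₁[0/N]≡-½ N) (P₁[0/N]≡-½ N))) (trans (-‿homo ℚ.1ℚ) (-‿cong 1#-homo))) ⟩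
      g 0 * - 1#                       ≈⟨ -‿distribʳ-* (g 0) 1# ⟨
      - (g 0 * 1#)                     ≈⟨ -‿cong (*-identityʳ (g 0)) ⟩
      - g 0                            ∎
      where open import Algebra.Properties.Ring ring using (-‿distribʳ-*)
    pair-odd : ∀ j → j ℕ.< N → ¬ j ≡ 0 → pair j ≈ 0#
    pair-odd zero    _   0≢0 = ⊥-elim (0≢0 ≡.refl)
    pair-odd (suc j) j<N _   = begin
      g (suc j) * p₋ (suc j) + g (suc j) * p₊ (suc j) ≈⟨ distribˡ (g (suc j)) _ _ ⟨
      g (suc j) * (p₋ (suc j) + p₊ (suc j))           ≈⟨ *-congˡ (+-homo _ _) ⟨
      g (suc j) * ι (P₁ ((ℤ.- + suc j) / N) ℚ.+ P₁ (+ suc j / N))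
        ≈⟨ *-congˡ (ι-cong (≡.trans (≡.cong (ℚ._+ P₁ (+ suc j / N)) (P₁-odd j<N)) (ℚP.+-inverseˡ (P₁ (+ suc j / N))))) ⟩
      g (suc j) * ι ℚ.0ℚ                              ≈⟨ *-congˡ 0#-homo ⟩
      g (suc j) * 0#                                  ≈⟨ zeroʳ _ ⟩
      0#                                              ∎
    paired : Σ< N pair ≈ - g 0
    paired = trans (Σ-only-0 N pair pair-odd) pair-0

  Σ-periodic-rows-distribution : ∀ a k N .{{_ : NonZero a}} .{{_ : NonZero N}} {W : ℤ → Carrier} → Periodic k W →
    (F : ℚ → ℚ) (u s u' : ℤ) → u ℤ.* + k ≡ + N ℤ.* u' →
    Σ< (a ℕ.* k) (λ n → W (+ n) * ι (F (_/_ (u ℤ.* + n ℤ.+ s) (a ℕ.* N) {{m*n≢0 a N}})))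
    ≈ Σ< k (λ j → W (+ j) * ι (ℚΣ.Σ< a (λ q → F (_/_ ((u ℤ.* + j ℤ.+ s) ℤ.+ + N ℤ.* (u' ℤ.* + q)) (a ℕ.* N) {{m*n≢0 a N}}))))
  Σ-periodic-rows-distribution a k N {W} W-periodic F u s u' uk≡Nu' =
    trans (Σ-periodic-rows a k W-periodic _)
          (Σ-cong′ k (λ j → *-congˡ (sym (trans (ι-Σ a _) (Σ-cong′ a (λ q → ι-cong (≡.cong (λ x → F (_/_ x (a ℕ.* N) {{m*n≢0 a N}})) (regroup q j))))))))
    where
    regroup : ∀ q j → (u ℤ.* + j ℤ.+ s) ℤ.+ + N ℤ.* (u' ℤ.* + q) ≡ u ℤ.* + (q ℕ.* k ℕ.+ j) ℤ.+ s
    regroup q j = ≡.trans (≡.cong (ℤ._+_ (u ℤ.* + j ℤ.+ s)) (≡.sym (ℤP.*-assoc (+ N) u' (+ q))))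
      (≡.trans (≡.cong (λ w → (u ℤ.* + j ℤ.+ s) ℤ.+ w ℤ.* + q) (≡.sym uk≡Nu'))
      (≡.trans (lemma u (+ j) s (+ k) (+ q))
        (≡.cong (λ w → u ℤ.* w ℤ.+ s) (≡.sym (≡.trans (ℤP.pos-+ (q ℕ.* k) j) (≡.cong (ℤ._+ + j) (ℤP.pos-* q k)))))))
      where lemma : ∀ u j s k q → (u ℤ.* j ℤ.+ s) ℤ.+ u ℤ.* k ℤ.* q ≡ u ℤ.* (q ℤ.* k ℤ.+ j) ℤ.+ s
            lemma = solve-∀

  Σ-periodic-P₁-rows : ∀ a k N .{{_ : NonZero a}} .{{_ : NonZero N}} {W : ℤ → Carrier} → Periodic k W →
    ∀ u s u' v' t → u ℤ.* + k ≡ + N ℤ.* u' → v' ℤ.* u' ≡ + 1 ℤ.+ t ℤ.* + a →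
    Σ< (a ℕ.* k) (λ n → W (+ n) * ι (P₁ (_/_ (u ℤ.* + n ℤ.+ s) (a ℕ.* N) {{m*n≢0 a N}})))
    ≈ Σ< k (λ j → W (+ j) * ι (P₁ ((u ℤ.* + j ℤ.+ s) / N)))
  Σ-periodic-P₁-rows a k N W-periodic u s u' v' t uk≡Nu' v'u'≡ =
    trans (Σ-periodic-rows-distribution a k N W-periodic P₁ u s u' uk≡Nu')
          (Σ-cong′ k (λ j → *-congˡ (ι-cong (P₁-distribution a N (u ℤ.* + j ℤ.+ s) u' v' t v'u'≡))))

  Σ-periodic-P₂-rows : ∀ a k N .{{_ : NonZero a}} .{{_ : NonZero N}} {W : ℤ → Carrier} → Periodic k W →
    ∀ u s u' v' t → u ℤ.* + k ≡ + N ℤ.* u' → v' ℤ.* u' ≡ + 1 ℤ.+ t ℤ.* + a →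
    Σ< (a ℕ.* k) (λ n → W (+ n) * ι (P₂ (_/_ (u ℤ.* + n ℤ.+ s) (a ℕ.* N) {{m*n≢0 a N}})))
    ≈ ι (+ 1 / a) * Σ< k (λ j → W (+ j) * ι (P₂ ((u ℤ.* + j ℤ.+ s) / N)))
  Σ-periodic-P₂-rows a k N W-periodic u s u' v' t uk≡Nu' v'u'≡ =
    trans (Σ-periodic-rows-distribution a k N W-periodic P₂ u s u' uk≡Nu')
          (trans (Σ-cong′ k (λ j → trans (*-congˡ (trans (ι-cong (P₂-distribution a N (u ℤ.* + j ℤ.+ s) u' v' t v'u'≡))
                                                         (*-homo _ _)))
                                         (x∙yz≈y∙xz _ _ _)))
                 (sym (*-distribˡ-Σ k _ _)))

  P₁C-/ : ∀ k .{{_ : NonZero k}} z y .{{_ : NonZero y}} (h : Seq) →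
          P₁C k (z / y) h ≈ Σ< k (λ j → h (ℤ.- + j) * ι (P₁ (_/_ (+ y ℤ.* + j ℤ.+ z) (y ℕ.* k) {{m*n≢0 y k}})))
  P₁C-/ k z y h = Σ-cong′ k (λ j → *-congˡ (ι-cong (≡.cong P₁ (shifted-fraction j z y k))))

  P₁C-0 : ∀ k .{{_ : NonZero k}} (h : Seq) → P₁C k ℚ.0ℚ h ≈ Σ< k (λ j → h (ℤ.- + j) * ι (P₁ (+ j / k)))
  P₁C-0 k h = Σ-cong′ k (λ j → *-congˡ (ι-cong (≡.cong P₁ (shifted-fraction-0 j k))))

  P₂C-0 : ∀ k .{{_ : NonZero k}} (h : Seq) → P₂C k ℚ.0ℚ h ≈ ι (ℕ→ℚ k) * Σ< k (λ j → h (ℤ.- + j) * ι (P₂ (+ j / k)))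
  P₂C-0 k h = *-congˡ (Σ-cong′ k (λ j → *-congˡ (ι-cong (≡.cong P₂ (shifted-fraction-0 j k)))))

  periodic-*-ι∘P : ∀ {k} N .{{_ : NonZero N}} (P : ℚ → ℚ) → (∀ a t → P ((a ℤ.+ t ℤ.* + N) / N) ≡ P (a / N)) →
                   ∀ {W} → Periodic k W → ∀ u s t → u ℤ.* + k ≡ t ℤ.* + N →
                   Periodic k (λ z → W z * ι (P ((u ℤ.* z ℤ.+ s) / N)))
  periodic-*-ι∘P {k} N P P-periodic W-periodic u s t uk≡tN z = *-cong (W-periodic z)
    (ι-cong (≡.trans (≡.cong (λ x → P (x / N)) (≡.trans (lemma u z (+ k) s) (≡.cong (ℤ._+_ (u ℤ.* z ℤ.+ s)) uk≡tN)))
                     (P-periodic (u ℤ.* z ℤ.+ s) t)))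
    where lemma : ∀ u z k s → u ℤ.* (z ℤ.+ k) ℤ.+ s ≡ (u ℤ.* z ℤ.+ s) ℤ.+ u ℤ.* k
          lemma = solve-∀

  Σ-reflect-ι∘P : ∀ k .{{_ : NonZero k}} (P : ℚ → ℚ) → (∀ a t → P ((a ℤ.+ t ℤ.* + k) / k) ≡ P (a / k)) →
                  ∀ {W} → Periodic k W →
                  Σ< k (λ j → W (ℤ.- + j) * ι (P (+ j / k))) ≈ Σ< k (λ j → W (+ j) * ι (P ((ℤ.- + j) / k)))
  Σ-reflect-ι∘P k P P-periodic {W} W-periodic = begin
    Σ< k (λ j → W (ℤ.- + j) * ι (P (+ j / k)))      ≈⟨ Σ-cong′ k (λ j → *-congˡ (ι-cong (≡.cong (λ x → P (x / k)) (lemma (+ j))))) ⟩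
    Σ< k (λ j → H (ℤ.- + j))                        ≈⟨ Σ-periodic-reflect k H-periodic ⟩
    Σ< k (λ j → H (+ j))                            ≈⟨ Σ-cong′ k (λ j → *-congˡ (ι-cong (≡.cong (λ x → P (x / k)) (lemma′ (+ j))))) ⟩
    Σ< k (λ j → W (+ j) * ι (P ((ℤ.- + j) / k)))    ∎
    where
    H : ℤ → Carrier
    H z = W z * ι (P ((ℤ.- + 1 ℤ.* z ℤ.+ + 0) / k))
    H-periodic : Periodic k H
    H-periodic = periodic-*-ι∘P k P P-periodic W-periodic (ℤ.- + 1) (+ 0) (ℤ.- + 1) ≡.refl
    lemma : ∀ j → j ≡ ℤ.- + 1 ℤ.* ℤ.- j ℤ.+ + 0
    lemma = solve-∀
    lemma′ : ∀ j → ℤ.- + 1 ℤ.* j ℤ.+ + 0 ≡ ℤ.- j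
    lemma′ = solve-∀

  Σ-periodic-periods : ∀ a k {W} → Periodic k W → Σ< (a ℕ.* k) (λ n → W (+ n)) ≈ ι (ℕ→ℚ a) * Σ< k (λ j → W (+ j))
  Σ-periodic-periods a k {W} W-periodic = begin
    Σ< (a ℕ.* k) (λ n → W (+ n))                      ≈⟨ Σ-cong′ (a ℕ.* k) (λ n → *-identityʳ _) ⟨
    Σ< (a ℕ.* k) (λ n → W (+ n) * 1#)                 ≈⟨ Σ-periodic-rows a k W-periodic (λ _ → 1#) ⟩
    Σ< k (λ j → W (+ j) * Σ< a (λ _ → 1#))            ≈⟨ Σ-cong′ k (λ j → trans (*-congˡ (trans (Σ-const a 1#) (*-identityʳ _))) (*-comm _ _)) ⟩
    Σ< k (λ j → ι (ℕ→ℚ a) * W (+ j))                  ≈⟨ *-distribˡ-Σ k _ _ ⟨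
    ι (ℕ→ℚ a) * Σ< k (λ j → W (+ j))                  ∎

  private
    ι-morphism : ℚ.+-*-rawRing ACR.-Raw-AlmostCommutative⟶ ACR.fromCommutativeRing R
    ι-morphism = record { ⟦_⟧ = ι ; +-homo = +-homo ; *-homo = *-homo ; -‿homo = -‿homo
                        ; 0-homo = 0#-homo ; 1-homo = 1#-homo }

    ι-≟ : ∀ p q → Maybe (ι p ≈ ι q)
    ι-≟ p q with p ℚP.≟ q
    ... | yes ≡.refl = just refl
    ... | no  _      = nothing

  module R-Solver = Ring-Solver ℚ.+-*-rawRing (ACR.fromCommutativeRing R) ι-morphism ι-≟

-- Summing the three-term relation over the lattice

module Reciprocity {a ℓ} (R : CommutativeRing a ℓ) (ι : ℚ → CommutativeRing.Carrier R) (hom : IsQAlgebraMap R ι)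
                   (k : ℕ) .{{_ : NonZero k}} (f f* : WithRing.Seq R ι)
                   (f-periodic : WithRing.Periodic R ι k f) (f*-periodic : WithRing.Periodic R ι k f*)
                   (c d : ℕ) .{{_ : NonZero c}} .{{_ : NonZero d}} (d' : ℕ) (d≡d'k : d ≡ d' ℕ.* k)
                   (b e : ℤ) (bc+1≡ed : b ℤ.* + c ℤ.+ + 1 ≡ e ℤ.* + d) where

  open CommutativeRing R
  open WithRing R ι
  open Sums R ι
  open QAlgebra R ι hom
  open RingMorphisms.IsRingHomomorphism hom using (+-homo; *-homo; 0#-homo; 1#-homo)
  open import Relation.Binary.Reasoning.Setoid setoid
  open import Algebra.Properties.CommutativeSemigroup *-commutativeSemigroup using (x∙yz≈y∙xz; xy∙z≈xz∙y)

  D C M : ℕ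
  D = d ℕ.* k
  C = c ℕ.* k
  M = c ℕ.* D

  instance
    D≢0 : NonZero D
    D≢0 = m*n≢0 d k
    C≢0 : NonZero C
    C≢0 = m*n≢0 c k
    M≢0 : NonZero M
    M≢0 = m*n≢0 c D

  fc fb : Seq
  fc = dil (+ c) f
  fb = dil b f*

  fc-periodic : Periodic k fc
  fc-periodic = dil-periodic (+ c) f-periodic

  fb-periodic : Periodic k fb
  fb-periodic = dil-periodic b f*-periodic

  private
    t : ℤ
    t = ℤ.- (e ℤ.* + d')

  -bc≡1+tk : ℤ.- b ℤ.* + c ≡ + 1 ℤ.+ t ℤ.* + k
  -bc≡1+tk = ≡.trans (lemma b (+ c)) (≡.trans (≡.cong (λ w → + 1 ℤ.- w) (≡.trans bc+1≡ed ed≡ed'k)) (lemma′ e (+ d') (+ k)))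
    where
    ed≡ed'k : e ℤ.* + d ≡ e ℤ.* + d' ℤ.* + k
    ed≡ed'k = ≡.trans (≡.cong (λ w → e ℤ.* + w) d≡d'k)
                      (≡.trans (≡.cong (e ℤ.*_) (ℤP.pos-* d' k)) (≡.sym (ℤP.*-assoc e (+ d') (+ k))))
    lemma : ∀ b c → ℤ.- b ℤ.* c ≡ + 1 ℤ.- (b ℤ.* c ℤ.+ + 1)
    lemma = solve-∀
    lemma′ : ∀ e d k → + 1 ℤ.- e ℤ.* d ℤ.* k ≡ + 1 ℤ.+ ℤ.- (e ℤ.* d) ℤ.* k
    lemma′ = solve-∀

  -cb≡1+tk : ℤ.- (+ c) ℤ.* b ≡ + 1 ℤ.+ t ℤ.* + k
  -cb≡1+tk = ≡.trans (lemma b (+ c)) -bc≡1+tk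
    where lemma : ∀ b c → ℤ.- c ℤ.* b ≡ ℤ.- b ℤ.* c
          lemma = solve-∀

  ed≡1+bc : e ℤ.* + d ≡ + 1 ℤ.+ b ℤ.* + c
  ed≡1+bc = ≡.trans (≡.sym bc+1≡ed) (ℤP.+-comm (b ℤ.* + c) (+ 1))

  Σf Σf* τ : Carrier
  Σf  = Σ< k (λ j → f (+ j))
  Σf* = Σ< k (λ j → f* (+ j))
  τ   = Σ< k (λ j → f (+ j) * ι (P₂ (+ j / k)))

  A₁ B₁ A₂ B₂ : Carrier
  A₁ = Σ< k (λ j → fc (+ j) * ι (P₁ (+ j / k)))
  B₁ = Σ< k (λ j → fb (+ j) * ι (P₁ (+ j / k)))
  A₂ = Σ< k (λ j → fc (+ j) * ι (P₂ (+ j / k)))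
  B₂ = Σ< k (λ j → fb (+ j) * ι (P₂ (+ j / k)))

  Σfc≈Σf : Σ< k (λ j → fc (+ j)) ≈ Σf
  Σfc≈Σf = trans (Σ-cong′ k (λ j → reflexive (≡.cong f (≡.sym (ℤP.+-identityʳ (+ c ℤ.* + j))))))
                 (Σ-periodic-affine k f-periodic (+ c) (ℤ.- b) (+ 0) t -bc≡1+tk)

  Σfb≈Σf* : Σ< k (λ j → fb (+ j)) ≈ Σf*
  Σfb≈Σf* = trans (Σ-cong′ k (λ j → reflexive (≡.cong f* (≡.sym (ℤP.+-identityʳ (b ℤ.* + j))))))
                  (Σ-periodic-affine k f*-periodic b (ℤ.- (+ c)) (+ 0) t -cb≡1+tk)

  private
    ιP₁-cong : ∀ {x y} L .{{_ : NonZero L}} → x ≡ y → ι (P₁ (x / L)) ≈ ι (P₁ (y / L))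
    ιP₁-cong L x≡y = ι-cong (≡.cong (λ z → P₁ (z / L)) x≡y)

    ιP₂-cong : ∀ {x y} L .{{_ : NonZero L}} → x ≡ y → ι (P₂ (x / L)) ≈ ι (P₂ (y / L))
    ιP₂-cong L x≡y = ι-cong (≡.cong (λ z → P₂ (z / L)) x≡y)

    1*n+0≡n : ∀ n → + 1 ℤ.* n ℤ.+ + 0 ≡ n
    1*n+0≡n = solve-∀

    -1*n+0≡-n : ∀ n → ℤ.- + 1 ℤ.* n ℤ.+ + 0 ≡ ℤ.- n
    -1*n+0≡-n = solve-∀

    -u*-n≡u*n : ∀ u n → ℤ.- u ℤ.* ℤ.- n ≡ u ℤ.* n
    -u*-n≡u*n = solve-∀

    k*1≡1*k : + 1 ℤ.* + k ≡ + k ℤ.* + 1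
    k*1≡1*k = ℤP.*-comm (+ 1) (+ k)

  Σ-fc-P₁ : Σ< D (λ n → fc (+ n) * ι (P₁ (+ n / D))) ≈ A₁
  Σ-fc-P₁ = trans (Σ-cong′ D (λ n → *-congˡ (ιP₁-cong D (≡.sym (1*n+0≡n (+ n))))))
    (trans (Σ-periodic-P₁-rows d k k fc-periodic (+ 1) (+ 0) (+ 1) (+ 1) (+ 0) k*1≡1*k ≡.refl)
           (Σ-cong′ k (λ j → *-congˡ (ιP₁-cong k (1*n+0≡n (+ j))))))

  Σ-fc-P₂ : Σ< D (λ n → fc (+ n) * ι (P₂ (+ n / D))) ≈ ι (+ 1 / d) * A₂
  Σ-fc-P₂ = trans (Σ-cong′ D (λ n → *-congˡ (ιP₂-cong D (≡.sym (1*n+0≡n (+ n))))))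
    (trans (Σ-periodic-P₂-rows d k k fc-periodic (+ 1) (+ 0) (+ 1) (+ 1) (+ 0) k*1≡1*k ≡.refl)
           (*-congˡ (Σ-cong′ k (λ j → *-congˡ (ιP₂-cong k (1*n+0≡n (+ j)))))))

  private
    -k≡-1*k : ℤ.- + 1 ℤ.* + k ≡ + k ℤ.* ℤ.- + 1
    -k≡-1*k = ℤP.*-comm (ℤ.- + 1) (+ k)

  Σ-fb-P₁⁻ : Σ< C (λ m → fb (+ m) * ι (P₁ ((ℤ.- + m) / C))) ≈ - B₁ - fb (+ 0)
  Σ-fb-P₁⁻ = trans (Σ-cong′ C (λ m → *-congˡ (ιP₁-cong C (≡.sym (-1*n+0≡-n (+ m))))))
    (trans (Σ-periodic-P₁-rows c k k fb-periodic (ℤ.- + 1) (+ 0) (ℤ.- + 1) (ℤ.- + 1) (+ 0) -k≡-1*k ≡.refl)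
      (trans (Σ-cong′ k (λ j → *-congˡ (ιP₁-cong k (-1*n+0≡-n (+ j)))))
             (Σ-P₁-reflect k (λ j → fb (+ j)))))

  Σ-fb-P₂⁻ : Σ< C (λ m → fb (+ m) * ι (P₂ ((ℤ.- + m) / C))) ≈ ι (+ 1 / c) * B₂
  Σ-fb-P₂⁻ = trans (Σ-cong′ C (λ m → *-congˡ (ιP₂-cong C (≡.sym (-1*n+0≡-n (+ m))))))
    (trans (Σ-periodic-P₂-rows c k k fb-periodic (ℤ.- + 1) (+ 0) (ℤ.- + 1) (ℤ.- + 1) (+ 0) -k≡-1*k ≡.refl)
           (*-congˡ (Σ-cong′ k (λ j → *-congˡ (ι-cong (≡.trans (≡.cong (λ x → P₂ (x / k)) (-1*n+0≡-n (+ j)))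
                                                                (P₂-even (+ j) k)))))))

  ζ : ℕ → ℕ → ℤ
  ζ n m = + d ℤ.* + m ℤ.+ ℤ.- (+ c) ℤ.* + n

  T₁-inner T₂-inner : ℕ → Carrier
  T₁-inner n = P₁C k ((ℤ.- (+ c) ℤ.* + n) / d) (dil (ℤ.- b) f*)
  T₂-inner m = P₁C k ((+ d ℤ.* + m) / c) (dil (+ c) f)

  private
    dk≡D*1 : + d ℤ.* + k ≡ + D ℤ.* + 1
    dk≡D*1 = ≡.trans (≡.sym (ℤP.pos-* d k)) (≡.sym (ℤP.*-identityʳ (+ D)))

    -ck≡C*-1 : ℤ.- (+ c) ℤ.* + k ≡ + C ℤ.* ℤ.- + 1
    -ck≡C*-1 = ≡.trans (lemma (+ c) (+ k)) (≡.cong (ℤ._* ℤ.- + 1) (≡.sym (ℤP.pos-* c k)))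
      where lemma : ∀ c k → ℤ.- c ℤ.* k ≡ (c ℤ.* k) ℤ.* ℤ.- + 1
            lemma = solve-∀

    M≡d*C : M ≡ d ℕ.* C
    M≡d*C = lemma c d k
      where lemma : ∀ c d k → c ℕ.* (d ℕ.* k) ≡ d ℕ.* (c ℕ.* k)
            lemma = ℕ-Solver.solve-∀
    ζ/M≡ : ∀ n m → ζ n m / M ≡ _/_ (ℤ.- (+ c) ℤ.* + n ℤ.+ + d ℤ.* + m) (d ℕ.* C) {{m*n≢0 d C}}
    ζ/M≡ n m = /-cong M (d ℕ.* C) {{_}} {{m*n≢0 d C}} (ℤP.+-comm (+ d ℤ.* + m) _) M≡d*C

  Σ-fb-z₁ : ∀ n → Σ< C (λ m → fb (+ m) * ι (P₁ (ζ n m / M))) ≈ T₁-inner n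
  Σ-fb-z₁ n = trans (Σ-periodic-P₁-rows c k D fb-periodic (+ d) (ℤ.- (+ c) ℤ.* + n) (+ 1) (+ 1) (+ 0) dk≡D*1 ≡.refl)
    (sym (trans (P₁C-/ k (ℤ.- (+ c) ℤ.* + n) d (dil (ℤ.- b) f*))
                (Σ-cong′ k (λ j → *-congʳ (reflexive (≡.cong f* (-u*-n≡u*n b (+ j))))))))

  Σ-fc-z₁ : ∀ m → Σ< D (λ n → fc (+ n) * ι (P₁ (ζ n m / M))) ≈ T₂-inner m
  Σ-fc-z₁ m = begin
    Σ< D (λ n → fc (+ n) * ι (P₁ (ζ n m / M)))
      ≈⟨ Σ-cong′ D (λ n → *-congˡ (ι-cong (≡.cong P₁ (ζ/M≡ n m)))) ⟩
    Σ< D (λ n → fc (+ n) * ι (P₁ (_/_ (ℤ.- (+ c) ℤ.* + n ℤ.+ + d ℤ.* + m) (d ℕ.* C) {{m*n≢0 d C}})))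
      ≈⟨ Σ-periodic-P₁-rows d k C fc-periodic (ℤ.- (+ c)) (+ d ℤ.* + m) (ℤ.- + 1) (ℤ.- + 1) (+ 0) -ck≡C*-1 ≡.refl ⟩
    Σ< k (λ j → H (+ j))       ≈⟨ Σ-periodic-reflect k H-periodic ⟨
    Σ< k (λ j → H (ℤ.- + j))
      ≈⟨ Σ-cong′ k (λ j → *-congˡ (ιP₁-cong C (≡.cong (ℤ._+ + d ℤ.* + m) (-u*-n≡u*n (+ c) (+ j))))) ⟩
    Σ< k (λ j → fc (ℤ.- + j) * ι (P₁ ((+ c ℤ.* + j ℤ.+ + d ℤ.* + m) / C)))
      ≈⟨ P₁C-/ k (+ d ℤ.* + m) c (dil (+ c) f) ⟨
    T₂-inner m ∎
    where
    H : ℤ → Carrier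
    H z = fc z * ι (P₁ ((ℤ.- (+ c) ℤ.* z ℤ.+ + d ℤ.* + m) / C))
    H-periodic : Periodic k H
    H-periodic = periodic-*-ι∘P C P₁ (λ a t → P₁-periodic a t C) fc-periodic (ℤ.- (+ c)) (+ d ℤ.* + m) (ℤ.- + 1)
                   (≡.trans -ck≡C*-1 (ℤP.*-comm (+ C) (ℤ.- + 1)))

  Σ-fc-z₂ : ∀ m → Σ< D (λ n → fc (+ n) * ι (P₂ (ζ n m / M)))
                  ≈ ι (+ 1 / d) * Σ< k (λ j → fc (+ j) * ι (P₂ ((ℤ.- (+ c) ℤ.* + j ℤ.+ + d ℤ.* + m) / C)))
  Σ-fc-z₂ m = trans (Σ-cong′ D (λ n → *-congˡ (ι-cong (≡.cong P₂ (ζ/M≡ n m)))))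
    (Σ-periodic-P₂-rows d k C fc-periodic (ℤ.- (+ c)) (+ d ℤ.* + m) (ℤ.- + 1) (ℤ.- + 1) (+ 0) -ck≡C*-1 ≡.refl)

  -- k ∣ d, so d i ≡ 0 (mod k) drops out of the fraction.
  Σ-fb-z₂ : ∀ j → Σ< C (λ m → fb (+ m) * ι (P₂ ((ℤ.- (+ c) ℤ.* + j ℤ.+ + d ℤ.* + m) / C)))
                  ≈ ι (+ 1 / c) * (Σf* * ι (P₂ ((+ c ℤ.* + j) / k)))
  Σ-fb-z₂ j = begin
    Σ< C (λ m → fb (+ m) * ι (P₂ ((ℤ.- (+ c) ℤ.* + j ℤ.+ + d ℤ.* + m) / C)))
      ≈⟨ Σ-cong′ C (λ m → *-congˡ (ιP₂-cong C (ℤP.+-comm (ℤ.- (+ c) ℤ.* + j) (+ d ℤ.* + m)))) ⟩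
    Σ< C (λ m → fb (+ m) * ι (P₂ ((+ d ℤ.* + m ℤ.+ ℤ.- (+ c) ℤ.* + j) / C)))
      ≈⟨ Σ-periodic-P₂-rows c k k fb-periodic (+ d) (ℤ.- (+ c) ℤ.* + j) (+ d) e b (ℤP.*-comm (+ d) (+ k)) ed≡1+bc ⟩
    ι (+ 1 / c) * Σ< k (λ i → fb (+ i) * ι (P₂ ((+ d ℤ.* + i ℤ.+ ℤ.- (+ c) ℤ.* + j) / k)))
      ≈⟨ *-congˡ (Σ-cong′ k (λ i → *-congˡ (ι-cong (drop-d i)))) ⟩
    ι (+ 1 / c) * Σ< k (λ i → fb (+ i) * ι (P₂ ((+ c ℤ.* + j) / k)))
      ≈⟨ *-congˡ (trans (sym (*-distribʳ-Σ k _ _)) (*-congʳ Σfb≈Σf*)) ⟩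
    ι (+ 1 / c) * (Σf* * ι (P₂ ((+ c ℤ.* + j) / k))) ∎
    where
    drop-d : ∀ i → P₂ ((+ d ℤ.* + i ℤ.+ ℤ.- (+ c) ℤ.* + j) / k) ≡ P₂ ((+ c ℤ.* + j) / k)
    drop-d i = ≡.trans (≡.cong (λ x → P₂ (x / k)) numerator≡)
                       (≡.trans (P₂-periodic (ℤ.- (+ c ℤ.* + j)) (+ i ℤ.* + d') k) (P₂-even (+ c ℤ.* + j) k))
      where
      numerator≡ : + d ℤ.* + i ℤ.+ ℤ.- (+ c) ℤ.* + j ≡ ℤ.- (+ c ℤ.* + j) ℤ.+ (+ i ℤ.* + d') ℤ.* + k
      numerator≡ = ≡.trans (≡.cong (λ w → + w ℤ.* + i ℤ.+ ℤ.- (+ c) ℤ.* + j) d≡d'k)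
                     (≡.trans (≡.cong (λ w → w ℤ.* + i ℤ.+ ℤ.- (+ c) ℤ.* + j) (ℤP.pos-* d' k)) (lemma (+ d') (+ k) (+ i) (+ c) (+ j)))
        where lemma : ∀ d' k i c j → (d' ℤ.* k) ℤ.* i ℤ.+ ℤ.- c ℤ.* j ≡ ℤ.- (c ℤ.* j) ℤ.+ (i ℤ.* d') ℤ.* k
              lemma = solve-∀

  Σ-fc-P₂-dilated≈τ : Σ< k (λ j → fc (+ j) * ι (P₂ ((+ c ℤ.* + j) / k))) ≈ τ
  Σ-fc-P₂-dilated≈τ = trans (Σ-cong′ k (λ j → reflexive (≡.cong H (≡.sym (ℤP.+-identityʳ (+ c ℤ.* + j))))))
                      (Σ-periodic-affine k H-periodic (+ c) (ℤ.- b) (+ 0) t -bc≡1+tk)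
    where
    H : ℤ → Carrier
    H z = f z * ι (P₂ (z / k))
    H-periodic : Periodic k H
    H-periodic z = *-cong (f-periodic z) (ι-cong (≡.trans (≡.cong (λ x → P₂ ((z ℤ.+ x) / k)) (≡.sym (ℤP.*-identityˡ (+ k))))
                                                         (P₂-periodic z (+ 1) k)))

  Θ : ℕ → ℕ → ℚ
  Θ n m = threeTerm M (+ c ℤ.* + n) (ℤ.- (+ d ℤ.* + m)) (ζ n m)

  private
    threeTerm-cong : ∀ {α α' β β' γ γ'} → α ≡ α' → β ≡ β' → γ ≡ γ' → threeTerm M α β γ ≡ threeTerm M α' β' γ'
    threeTerm-cong ≡.refl ≡.refl ≡.refl = ≡.refl

    Θ[0,0]≡1 : Θ 0 0 ≡ ℚ.1ℚ
    Θ[0,0]≡1 = ≡.trans (threeTerm-cong (ℤP.*-zeroʳ (+ c)) (≡.cong ℤ.-_ (ℤP.*-zeroʳ (+ d))) (lemma (+ c) (+ d)))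
                       (threeTerm-0 M)
      where lemma : ∀ c d → d ℤ.* + 0 ℤ.+ ℤ.- c ℤ.* + 0 ≡ + 0
            lemma = solve-∀

    multiple-below⇒0 : ∀ {n X} → X ℕD.∣ n → n ℕ.< X → n ≡ 0
    multiple-below⇒0 {zero}  _   _   = ≡.refl
    multiple-below⇒0 {suc n} X∣n n<X = ⊥-elim (ℕP.<⇒≱ n<X (ℕD.∣⇒≤ X∣n))

    cn≡0⇒n≡0 : ∀ n → n ℕ.< D → (+ c ℤ.* + n) ℤ.%ℕ M ≡ 0 → n ≡ 0
    cn≡0⇒n≡0 n n<D cn≡0 = multiple-below⇒0 (ℕD.*-cancelˡ-∣ c
      (ℕD.m%n≡0⇒n∣m (c ℕ.* n) M (≡.trans (≡.cong (ℤ._%ℕ M) (ℤP.pos-* c n)) cn≡0))) n<D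

    -dm≡0⇒m≡0 : ∀ m → m ℕ.< C → (ℤ.- (+ d ℤ.* + m)) ℤ.%ℕ M ≡ 0 → m ≡ 0
    -dm≡0⇒m≡0 m m<C -dm≡0 = multiple-below⇒0 (ℕD.*-cancelˡ-∣ d (≡.subst (ℕD._∣ d ℕ.* m) M≡d*C
      (ℕD.m%n≡0⇒n∣m (d ℕ.* m) M (≡.trans (≡.cong (ℤ._%ℕ M) (ℤP.pos-* d m)) dm≡0)))) m<C
      where dm≡0 : (+ d ℤ.* + m) ℤ.%ℕ M ≡ 0
            dm≡0 = ≡.subst (λ x → x ℤ.%ℕ M ≡ 0) (ℤP.neg-involutive (+ d ℤ.* + m))
                           (a%ℕN≡0⇒-a%ℕN≡0 (ℤ.- (+ d ℤ.* + m)) M -dm≡0)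

  Θ-vanishes : ∀ n m → n ℕ.< D → m ℕ.< C → (¬ n ≡ 0 ⊎ ¬ m ≡ 0) → Θ n m ≡ ℚ.0ℚ
  Θ-vanishes n m n<D m<C n,m≢0 with threeTerm-vanishes M (+ c ℤ.* + n) (ℤ.- (+ d ℤ.* + m)) (ζ n m) (lemma (+ c) (+ d) (+ n) (+ m))
    where lemma : ∀ c d n m → c ℤ.* n ℤ.+ ℤ.- (d ℤ.* m) ℤ.+ (d ℤ.* m ℤ.+ ℤ.- c ℤ.* n) ≡ + 0
          lemma = solve-∀
  ... | inj₂ Θ≡0 = Θ≡0
  ... | inj₁ (cn≡0 , -dm≡0) with n,m≢0
  ...   | inj₁ n≢0 = ⊥-elim (n≢0 (cn≡0⇒n≡0 n n<D cn≡0))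
  ...   | inj₂ m≢0 = ⊥-elim (m≢0 (-dm≡0⇒m≡0 m m<C -dm≡0))

  lattice-sum : Σ< D (λ n → Σ< C (λ m → (fc (+ n) * fb (+ m)) * ι (Θ n m))) ≈ fc (+ 0) * fb (+ 0)
  lattice-sum = begin
    Σ< D (λ n → Σ< C (λ m → (fc (+ n) * fb (+ m)) * ι (Θ n m)))
      ≈⟨ Σ-only-0 D _ (λ n n<D n≢0 → trans (Σ-cong C (λ m m<C → term-vanishes n m n<D m<C (inj₁ n≢0))) (Σ-zero C)) ⟩
    Σ< C (λ m → (fc (+ 0) * fb (+ m)) * ι (Θ 0 m))
      ≈⟨ Σ-only-0 C _ (λ m m<C m≢0 → term-vanishes 0 m (ℕ.>-nonZero⁻¹ D) m<C (inj₂ m≢0)) ⟩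
    (fc (+ 0) * fb (+ 0)) * ι (Θ 0 0)   ≈⟨ *-congˡ (trans (ι-cong Θ[0,0]≡1) 1#-homo) ⟩
    (fc (+ 0) * fb (+ 0)) * 1#          ≈⟨ *-identityʳ _ ⟩
    fc (+ 0) * fb (+ 0)                 ∎
    where
    term-vanishes : ∀ n m → n ℕ.< D → m ℕ.< C → (¬ n ≡ 0 ⊎ ¬ m ≡ 0) → (fc (+ n) * fb (+ m)) * ι (Θ n m) ≈ 0#
    term-vanishes n m n<D m<C n,m≢0 = trans (*-congˡ (trans (ι-cong (Θ-vanishes n m n<D m<C n,m≢0)) 0#-homo)) (zeroʳ _)

  x₁ x₂ y₁ y₂ : ℕ → Carrier
  x₁ n = ι (P₁ (+ n / D))
  x₂ n = ι (P₂ (+ n / D))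
  y₁ m = ι (P₁ ((ℤ.- + m) / C))
  y₂ m = ι (P₂ ((ℤ.- + m) / C))

  z₁ z₂ : ℕ → ℕ → Carrier
  z₁ n m = ι (P₁ (ζ n m / M))
  z₂ n m = ι (P₂ (ζ n m / M))

  ι-Θ : ∀ n m → ι (Θ n m) ≈ x₁ n * y₁ m + y₁ m * z₁ n m + z₁ n m * x₁ n + (x₂ n + y₂ m + z₂ n m)
  ι-Θ n m = trans (+-homo _ _) (+-cong
    (trans (+-homo _ _) (+-cong (trans (+-homo _ _) (+-cong (trans (*-homo _ _) (*-cong (ι-cong (≡.cong P₁ cn/M≡n/D))
                                                                                            (ι-cong (≡.cong P₁ -dm/M≡-m/C))))
                                                            (trans (*-homo _ _) (*-congʳ (ι-cong (≡.cong P₁ -dm/M≡-m/C))))))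
                                (trans (*-homo _ _) (*-congˡ (ι-cong (≡.cong P₁ cn/M≡n/D))))))
    (trans (+-homo _ _) (+-congʳ (trans (+-homo _ _) (+-cong (ι-cong (≡.cong P₂ cn/M≡n/D)) (ι-cong (≡.cong P₂ -dm/M≡-m/C)))))))
    where
    cn/M≡n/D : (+ c ℤ.* + n) / M ≡ + n / D
    cn/M≡n/D = cross-multiply (+ c ℤ.* + n) (+ n) M D
      (≡.trans (lemma (+ c) (+ n) (+ D)) (≡.cong (+ n ℤ.*_) (≡.sym (ℤP.pos-* c D))))
      where lemma : ∀ c n D → (c ℤ.* n) ℤ.* D ≡ n ℤ.* (c ℤ.* D)
            lemma = solve-∀
    -dm/M≡-m/C : (ℤ.- (+ d ℤ.* + m)) / M ≡ (ℤ.- + m) / C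
    -dm/M≡-m/C = cross-multiply (ℤ.- (+ d ℤ.* + m)) (ℤ.- + m) M C
      (≡.trans (≡.cong (ℤ.- (+ d ℤ.* + m) ℤ.*_) (ℤP.pos-* c k))
        (≡.trans (lemma (+ c) (+ d) (+ k) (+ m))
          (≡.cong (ℤ.- + m ℤ.*_) (≡.sym (≡.trans (ℤP.pos-* c D) (≡.cong (+ c ℤ.*_) (ℤP.pos-* d k)))))))
      where lemma : ∀ c d k m → ℤ.- (d ℤ.* m) ℤ.* (c ℤ.* k) ≡ ℤ.- m ℤ.* (c ℤ.* (d ℤ.* k))
            lemma = solve-∀

  S₁ S₂ S₃ S₄ S₅ S₆ : Carrier
  S₁ = Σ< D (λ n → Σ< C (λ m → (fc (+ n) * x₁ n) * (fb (+ m) * y₁ m)))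
  S₂ = Σ< D (λ n → Σ< C (λ m → (fb (+ m) * y₁ m) * (fc (+ n) * z₁ n m)))
  S₃ = Σ< D (λ n → Σ< C (λ m → (fc (+ n) * x₁ n) * (fb (+ m) * z₁ n m)))
  S₄ = Σ< D (λ n → Σ< C (λ m → (fc (+ n) * x₂ n) * fb (+ m)))
  S₅ = Σ< D (λ n → Σ< C (λ m → (fb (+ m) * y₂ m) * fc (+ n)))
  S₆ = Σ< D (λ n → Σ< C (λ m → fc (+ n) * (fb (+ m) * z₂ n m)))

  lattice-sum≈S : Σ< D (λ n → Σ< C (λ m → (fc (+ n) * fb (+ m)) * ι (Θ n m))) ≈ S₁ + S₂ + S₃ + (S₄ + S₅ + S₆)
  lattice-sum≈S = trans (Σ-cong′ D (λ n → trans (Σ-cong′ C (λ m → trans (*-congˡ (ι-Θ n m)) (expand _ _ _ _ _ _ _ _)))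
                                                (Σ-distrib-six C _ _ _ _ _ _)))
                        (Σ-distrib-six D _ _ _ _ _ _)
    where
    open R-Solver using (solve; _:=_; _:+_; _:*_)
    expand : ∀ a b x y z x' y' z' → (a * b) * (x * y + y * z + z * x + (x' + y' + z')) ≈
             (a * x) * (b * y) + (b * y) * (a * z) + (a * x) * (b * z) + ((a * x') * b + (b * y') * a + a * (b * z'))
    expand = solve 8 (λ a b x y z x' y' z' → (a :* b) :* (x :* y :+ y :* z :+ z :* x :+ (x' :+ y' :+ z')) :=
             (a :* x) :* (b :* y) :+ (b :* y) :* (a :* z) :+ (a :* x) :* (b :* z) :+ ((a :* x') :* b :+ (b :* y') :* a :+ a :* (b :* z'))) refl
    Σ-distrib-six : ∀ N (h₁ h₂ h₃ h₄ h₅ h₆ : ℕ → Carrier) →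
      Σ< N (λ i → h₁ i + h₂ i + h₃ i + (h₄ i + h₅ i + h₆ i)) ≈ Σ< N h₁ + Σ< N h₂ + Σ< N h₃ + (Σ< N h₄ + Σ< N h₅ + Σ< N h₆)
    Σ-distrib-six N h₁ h₂ h₃ h₄ h₅ h₆ = trans (Σ-distrib-+ N _ _)
      (+-cong (trans (Σ-distrib-+ N _ _) (+-congʳ (Σ-distrib-+ N _ _))) (trans (Σ-distrib-+ N _ _) (+-congʳ (Σ-distrib-+ N _ _))))

  T₁ T₂ : Carrier
  T₁ = Σ< D (λ n → fc (+ n) * x₁ n * T₁-inner n)
  T₂ = Σ< C (λ m → fb (+ m) * ι (P₁ (+ m / C)) * T₂-inner m)

  T₂-inner-0 : T₂-inner 0 ≈ - A₁ - fc (+ 0)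
  T₂-inner-0 = begin
    T₂-inner 0                                                ≈⟨ P₁C-/ k (+ d ℤ.* + 0) c (dil (+ c) f) ⟩
    Σ< k (λ j → fc (ℤ.- + j) * ι (P₁ ((+ c ℤ.* + j ℤ.+ + d ℤ.* + 0) / C)))
      ≈⟨ Σ-cong′ k (λ j → *-congˡ (ι-cong (≡.cong P₁ (cross-multiply (+ c ℤ.* + j ℤ.+ + d ℤ.* + 0) (+ j) C k (≡.trans (lemma (+ c) (+ d) (+ j) (+ k))
                                                                  (≡.cong (+ j ℤ.*_) (≡.sym (ℤP.pos-* c k)))))))) ⟩
    Σ< k (λ j → fc (ℤ.- + j) * ι (P₁ (+ j / k)))            ≈⟨ Σ-reflect-ι∘P k P₁ (λ a t → P₁-periodic a t k) fc-periodic ⟩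
    Σ< k (λ j → fc (+ j) * ι (P₁ ((ℤ.- + j) / k)))          ≈⟨ Σ-P₁-reflect k (λ j → fc (+ j)) ⟩
    - A₁ - fc (+ 0)                                           ∎
    where lemma : ∀ c d j k → (c ℤ.* j ℤ.+ d ℤ.* + 0) ℤ.* k ≡ j ℤ.* (c ℤ.* k)
          lemma = solve-∀

  S₁≈ : S₁ ≈ A₁ * (- B₁ - fb (+ 0))
  S₁≈ = trans (Σ-*-Σ D C _ _) (*-cong Σ-fc-P₁ Σ-fb-P₁⁻)

  S₂≈ : S₂ ≈ - T₂ - fb (+ 0) * T₂-inner 0
  S₂≈ = begin
    S₂                                                        ≈⟨ Σ-comm D C _ ⟩
    Σ< C (λ m → Σ< D (λ n → (fb (+ m) * y₁ m) * (fc (+ n) * z₁ n m)))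
      ≈⟨ Σ-cong′ C (λ m → trans (sym (*-distribˡ-Σ D _ _)) (*-congˡ (Σ-fc-z₁ m))) ⟩
    Σ< C (λ m → (fb (+ m) * y₁ m) * T₂-inner m)              ≈⟨ Σ-cong′ C (λ m → xy∙z≈xz∙y _ _ _) ⟩
    Σ< C (λ m → (fb (+ m) * T₂-inner m) * y₁ m)              ≈⟨ Σ-P₁-reflect C (λ m → fb (+ m) * T₂-inner m) ⟩
    - Σ< C (λ m → (fb (+ m) * T₂-inner m) * ι (P₁ (+ m / C))) - fb (+ 0) * T₂-inner 0
      ≈⟨ +-congʳ (-‿cong (Σ-cong′ C (λ m → xy∙z≈xz∙y _ _ _))) ⟩
    - T₂ - fb (+ 0) * T₂-inner 0                              ∎

  S₃≈ : S₃ ≈ T₁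
  S₃≈ = Σ-cong′ D (λ n → trans (sym (*-distribˡ-Σ C _ _)) (*-congˡ (Σ-fb-z₁ n)))

  S₄≈ : S₄ ≈ (ι (+ 1 / d) * A₂) * (ι (ℕ→ℚ c) * Σf*)
  S₄≈ = trans (Σ-*-Σ D C _ _) (*-cong Σ-fc-P₂ (trans (Σ-periodic-periods c k fb-periodic) (*-congˡ Σfb≈Σf*)))

  S₅≈ : S₅ ≈ (ι (+ 1 / c) * B₂) * (ι (ℕ→ℚ d) * Σf)
  S₅≈ = trans (Σ-comm D C _) (trans (Σ-*-Σ C D _ _) (*-cong Σ-fb-P₂⁻ (trans (Σ-periodic-periods d k fc-periodic) (*-congˡ Σfc≈Σf))))

  S₆≈ : S₆ ≈ ι (+ 1 / d) * ((ι (+ 1 / c) * Σf*) * τ)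
  S₆≈ = begin
    S₆                                                                  ≈⟨ Σ-comm D C _ ⟩
    Σ< C (λ m → Σ< D (λ n → fc (+ n) * (fb (+ m) * z₂ n m)))
      ≈⟨ Σ-cong′ C (λ m → trans (Σ-cong′ D (λ n → x∙yz≈y∙xz _ _ _)) (sym (*-distribˡ-Σ D _ _))) ⟩
    Σ< C (λ m → fb (+ m) * Σ< D (λ n → fc (+ n) * z₂ n m))
      ≈⟨ Σ-cong′ C (λ m → trans (*-congˡ (Σ-fc-z₂ m)) (x∙yz≈y∙xz _ _ _)) ⟩
    Σ< C (λ m → ι (+ 1 / d) * (fb (+ m) * Σ< k (λ j → fc (+ j) * p m j))) ≈⟨ *-distribˡ-Σ C _ _ ⟨
    ι (+ 1 / d) * Σ< C (λ m → fb (+ m) * Σ< k (λ j → fc (+ j) * p m j))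
      ≈⟨ *-congˡ (Σ-cong′ C (λ m → trans (*-distribˡ-Σ k _ _) (Σ-cong′ k (λ j → x∙yz≈y∙xz _ _ _)))) ⟩
    ι (+ 1 / d) * Σ< C (λ m → Σ< k (λ j → fc (+ j) * (fb (+ m) * p m j)))  ≈⟨ *-congˡ (Σ-comm C k _) ⟩
    ι (+ 1 / d) * Σ< k (λ j → Σ< C (λ m → fc (+ j) * (fb (+ m) * p m j)))
      ≈⟨ *-congˡ (Σ-cong′ k (λ j → trans (sym (*-distribˡ-Σ C _ _)) (*-congˡ (Σ-fb-z₂ j)))) ⟩
    ι (+ 1 / d) * Σ< k (λ j → fc (+ j) * (ι (+ 1 / c) * (Σf* * ι (P₂ ((+ c ℤ.* + j) / k)))))
      ≈⟨ *-congˡ (Σ-cong′ k (λ j → trans (*-congˡ (sym (*-assoc _ _ _))) (x∙yz≈y∙xz _ _ _))) ⟩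
    ι (+ 1 / d) * Σ< k (λ j → (ι (+ 1 / c) * Σf*) * (fc (+ j) * ι (P₂ ((+ c ℤ.* + j) / k))))
      ≈⟨ *-congˡ (trans (sym (*-distribˡ-Σ k _ _)) (*-congˡ Σ-fc-P₂-dilated≈τ)) ⟩
    ι (+ 1 / d) * ((ι (+ 1 / c) * Σf*) * τ)                               ∎
    where
    p : ℕ → ℕ → Carrier
    p m j = ι (P₂ ((ℤ.- (+ c) ℤ.* + j ℤ.+ + d ℤ.* + m) / C))

  private
    +N≡0+1*N : ∀ N → + N ≡ + 0 ℤ.+ + 1 ℤ.* + N
    +N≡0+1*N N = ≡.sym (≡.trans (ℤP.+-identityˡ _) (ℤP.*-identityˡ (+ N)))

    P₁[N/N]≡P₁[0/N] : ∀ N .{{_ : NonZero N}} → P₁ (+ N / N) ≡ P₁ (+ 0 / N)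
    P₁[N/N]≡P₁[0/N] N = ≡.trans (≡.cong (λ x → P₁ (x / N)) (+N≡0+1*N N)) (P₁-periodic (+ 0) (+ 1) N)

    P₁C-/-shift : ∀ y z z' t .{{_ : NonZero y}} (h : Seq) → z' ≡ z ℤ.+ t ℤ.* + (y ℕ.* k) →
                  P₁C k (z' / y) h ≈ P₁C k (z / y) h
    P₁C-/-shift y z z' t h z'≡ = trans (P₁C-/ k z' y h) (trans (Σ-cong′ k (λ j → *-congˡ (ι-cong
      (≡.trans (≡.cong (λ x → P₁ (_/_ x (y ℕ.* k) {{m*n≢0 y k}}))
                       (≡.trans (≡.cong (ℤ._+_ (+ y ℤ.* + j)) z'≡) (≡.sym (ℤP.+-assoc (+ y ℤ.* + j) z (t ℤ.* + (y ℕ.* k))))))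
               (P₁-periodic (+ y ℤ.* + j ℤ.+ z) t (y ℕ.* k) {{m*n≢0 y k}})))))
      (sym (P₁C-/ k z y h)))

    x*N≡x*0+x*N : ∀ x N → x ℤ.* N ≡ x ℤ.* + 0 ℤ.+ x ℤ.* N
    x*N≡x*0+x*N = solve-∀

    +[a*k]≡0+a*k : ∀ a → + (a ℕ.* k) ≡ + 0 ℤ.+ + a ℤ.* + k
    +[a*k]≡0+a*k a = ≡.sym (≡.trans (ℤP.+-identityˡ _) (≡.sym (ℤP.pos-* a k)))

  sDed-left≈T₁ : sDed k (ℤ.- (+ c)) d fc (dil (ℤ.- b) f*) ≈ T₁
  sDed-left≈T₁ = Σ₁≈Σ< D _ (*-cong (*-cong fc[D]≈fc[0] (ι-cong (P₁[N/N]≡P₁[0/N] D)))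
                                    (P₁C-/-shift d (ℤ.- (+ c) ℤ.* + 0) (ℤ.- (+ c) ℤ.* + D) (ℤ.- (+ c)) (dil (ℤ.- b) f*) (x*N≡x*0+x*N (ℤ.- (+ c)) (+ D))))
    where fc[D]≈fc[0] : fc (+ D) ≈ fc (+ 0)
          fc[D]≈fc[0] = trans (reflexive (≡.cong fc (+[a*k]≡0+a*k d))) (periodic-multiple fc-periodic (+ 0) (+ d))

  sDed-right≈T₂ : sDed k (+ d) c fb fc ≈ T₂
  sDed-right≈T₂ = Σ₁≈Σ< C _ (*-cong (*-cong fb[C]≈fb[0] (ι-cong (P₁[N/N]≡P₁[0/N] C)))
                                     (P₁C-/-shift c (+ d ℤ.* + 0) (+ d ℤ.* + C) (+ d) fc (x*N≡x*0+x*N (+ d) (+ C))))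
    where fb[C]≈fb[0] : fb (+ C) ≈ fb (+ 0)
          fb[C]≈fb[0] = trans (reflexive (≡.cong fb (+[a*k]≡0+a*k c))) (periodic-multiple fb-periodic (+ 0) (+ c))

  P₁C[0,-b]≈B₁ : P₁C k ℚ.0ℚ (dil (ℤ.- b) f*) ≈ B₁
  P₁C[0,-b]≈B₁ = trans (P₁C-0 k (dil (ℤ.- b) f*)) (Σ-cong′ k (λ j → *-congʳ (reflexive (≡.cong f* (-u*-n≡u*n b (+ j))))))

  P₁C[0,-c]≈A₁ : P₁C k ℚ.0ℚ (dil (ℤ.- (+ c)) f) ≈ A₁
  P₁C[0,-c]≈A₁ = trans (P₁C-0 k (dil (ℤ.- (+ c)) f)) (Σ-cong′ k (λ j → *-congʳ (reflexive (≡.cong f (-u*-n≡u*n (+ c) (+ j))))))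

  private
    P₂C-0-periodic : ∀ {W} → Periodic k W →
                     P₂C k ℚ.0ℚ W ≈ ι (ℕ→ℚ k) * Σ< k (λ j → W (+ j) * ι (P₂ (+ j / k)))
    P₂C-0-periodic {W} W-periodic = trans (P₂C-0 k W) (*-congˡ (trans (Σ-reflect-ι∘P k P₂ (λ a t → P₂-periodic a t k) W-periodic)
                                                                 (Σ-cong′ k (λ j → *-congˡ (ι-cong (P₂-even (+ j) k))))))

  P₂C[0,b]≈kB₂ : P₂C k ℚ.0ℚ fb ≈ ι (ℕ→ℚ k) * B₂
  P₂C[0,b]≈kB₂ = P₂C-0-periodic fb-periodic

  P₂C[0,c]≈kA₂ : P₂C k ℚ.0ℚ fc ≈ ι (ℕ→ℚ k) * A₂
  P₂C[0,c]≈kA₂ = P₂C-0-periodic fc-periodic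

  Bern₂≈2kτ : Bern₂ k f ≈ ι (ℕ→ℚ k) * (ι (+ 2 / 1) * τ)
  Bern₂≈2kτ = *-congˡ (trans (Σ-cong k (λ n n<k → *-congˡ (trans (ι-cong (bern₂≡2P₂ n n<k)) (*-homo _ _))))
                             (trans (Σ-cong′ k (λ n → x∙yz≈y∙xz _ _ _)) (sym (*-distribˡ-Σ k _ _))))
    where
    bern₂≡2P₂ : ∀ n → n ℕ.< k → bern₂ (+ n / k) ≡ (+ 2 / 1) ℚ.* P₂ (+ n / k)
    bern₂≡2P₂ n n<k = ≡.trans (twice-half (bern₂ (+ n / k)))
                        (≡.cong (λ x → (+ 2 / 1) ℚ.* (bern₂ x ℚ.* (+ 1 / 2))) (≡.sym (n<N⇒frac[n/N]≡n/N n<k)))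
      where
      open import Data.Rational.Solver
      open +-*-Solver
      twice-half : ∀ y → y ≡ (+ 2 / 1) ℚ.* (y ℚ.* (+ 1 / 2))
      twice-half = solve 1 (λ y → y := con (+ 2 / 1) :* (y :* con (+ 1 / 2))) ≡.refl

  private
    open R-Solver using (solve; _:=_; _:+_; _:*_; :-_; _:-_)

    ι[p*1/k*k]≈ιp : ∀ p → ι p * ι (+ 1 / k) * ι (ℕ→ℚ k) ≈ ι p
    ι[p*1/k*k]≈ιp p = trans (sym (trans (*-homo _ _) (*-congʳ (*-homo _ _)))) (ι-cong ([p*1/k]*k≡p p k))

    undo-Bern₀-scaling : ∀ p s t → ι p * (ι (+ 1 / k) * s) * (ι (ℕ→ℚ k) * t) ≈ ι p * (s * t)
    undo-Bern₀-scaling p s t = trans (regroup (ι p) (ι (+ 1 / k)) (ι (ℕ→ℚ k)) s t) (*-congʳ (ι[p*1/k*k]≈ιp p))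
      where regroup : ∀ p q r s t → p * (q * s) * (r * t) ≈ (p * q * r) * (s * t)
            regroup = solve 5 (λ p q r s t → p :* (q :* s) :* (r :* t) := (p :* q :* r) :* (s :* t)) refl

    ι[x/y]-regroup : ∀ x y .{{_ : NonZero y}} s t → ι (+ x / y) * (s * t) ≈ (ι (+ 1 / y) * t) * (ι (ℕ→ℚ x) * s)
    ι[x/y]-regroup x y s t = trans (*-congʳ (trans (ι-cong (x/y≡1/y*x x y)) (*-homo _ _))) (regroup _ _ s t)
      where regroup : ∀ p q s t → (p * q) * (s * t) ≈ (p * t) * (q * s)
            regroup = solve 4 (λ p q s t → (p :* q) :* (s :* t) := (p :* t) :* (q :* s)) refl

  X₄ X₅ X₆ : Carrier
  X₄ = (ι (+ 1 / d) * A₂) * (ι (ℕ→ℚ c) * Σf*)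
  X₅ = (ι (+ 1 / c) * B₂) * (ι (ℕ→ℚ d) * Σf)
  X₆ = ι (+ 1 / d) * ((ι (+ 1 / c) * Σf*) * τ)

  X₄≈ : ι (+ c / d) * Bern₀ k f* * P₂C k ℚ.0ℚ fc ≈ X₄
  X₄≈ = trans (*-congˡ P₂C[0,c]≈kA₂) (trans (undo-Bern₀-scaling (+ c / d) Σf* A₂) (ι[x/y]-regroup c d Σf* A₂))

  X₅≈ : ι (+ d / c) * Bern₀ k f * P₂C k ℚ.0ℚ fb ≈ X₅
  X₅≈ = trans (*-congˡ P₂C[0,b]≈kB₂) (trans (undo-Bern₀-scaling (+ d / c) Σf B₂) (ι[x/y]-regroup d c Σf B₂))

  X₆≈ : ι (_/_ (+ 1) (2 ℕ.* (d ℕ.* c)) {{m*n≢0 2 (d ℕ.* c) {{_}} {{m*n≢0 d c}}}}) * Bern₀ k f* * Bern₂ k f ≈ X₆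
  X₆≈ = begin
    ι K * Bern₀ k f* * Bern₂ k f                ≈⟨ *-congˡ Bern₂≈2kτ ⟩
    ι K * (ι (+ 1 / k) * Σf*) * (ι (ℕ→ℚ k) * (ι (+ 2 / 1) * τ)) ≈⟨ undo-Bern₀-scaling K Σf* (ι (+ 2 / 1) * τ) ⟩
    ι K * (Σf* * (ι (+ 2 / 1) * τ))             ≈⟨ regroup _ _ _ _ ⟩
    (ι K * ι (+ 2 / 1)) * (Σf* * τ)             ≈⟨ *-congʳ (trans (sym (*-homo _ _)) (trans (ι-cong (1/[2mn]*2≡1/m*1/n d c)) (*-homo _ _))) ⟩
    (ι (+ 1 / d) * ι (+ 1 / c)) * (Σf* * τ)     ≈⟨ regroup′ _ _ _ _ ⟩
    X₆                                          ∎
    where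
    K = _/_ (+ 1) (2 ℕ.* (d ℕ.* c)) {{m*n≢0 2 (d ℕ.* c) {{_}} {{m*n≢0 d c}}}}
    regroup : ∀ p s q t → p * (s * (q * t)) ≈ (p * q) * (s * t)
    regroup = solve 4 (λ p s q t → p :* (s :* (q :* t)) := (p :* q) :* (s :* t)) refl
    regroup′ : ∀ p q s t → (p * q) * (s * t) ≈ p * ((q * s) * t)
    regroup′ = solve 4 (λ p q s t → (p :* q) :* (s :* t) := p :* ((q :* s) :* t)) refl

  solve-for-T₁-T₂ : ∀ T₁ T₂ a b A₀ B₀ I₀ X₄ X₅ X₆ →
                    a * (- b - B₀) + (- T₂ - B₀ * I₀) + T₁ + (X₄ + X₅ + X₆) ≈ A₀ * B₀ → I₀ ≈ - a - A₀ →
                    T₁ - T₂ ≈ b * a - X₅ - X₄ - X₆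
  solve-for-T₁-T₂ T₁ T₂ a b A₀ B₀ I₀ X₄ X₅ X₆ lattice I₀≈ = begin
    T₁ - T₂                                                    ≈⟨ expand T₁ T₂ a b A₀ B₀ X₄ X₅ X₆ ⟩
    (a * (- b - B₀) + (- T₂ - B₀ * (- a - A₀)) + T₁ + (X₄ + X₅ + X₆)) + (- (A₀ * B₀) + b * a - X₅ - X₄ - X₆)
      ≈⟨ +-congʳ (+-congʳ (+-congʳ (+-congˡ (+-congˡ (-‿cong (*-congˡ (sym I₀≈))))))) ⟩
    (a * (- b - B₀) + (- T₂ - B₀ * I₀) + T₁ + (X₄ + X₅ + X₆)) + (- (A₀ * B₀) + b * a - X₅ - X₄ - X₆)
      ≈⟨ +-congʳ lattice ⟩
    A₀ * B₀ + (- (A₀ * B₀) + b * a - X₅ - X₄ - X₆)            ≈⟨ cancel A₀ B₀ a b X₄ X₅ X₆ ⟩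
    b * a - X₅ - X₄ - X₆                                       ∎
    where
    expand : ∀ T₁ T₂ a b A₀ B₀ X₄ X₅ X₆ → T₁ - T₂ ≈
      (a * (- b - B₀) + (- T₂ - B₀ * (- a - A₀)) + T₁ + (X₄ + X₅ + X₆)) + (- (A₀ * B₀) + b * a - X₅ - X₄ - X₆)
    expand = solve 9 (λ T₁ T₂ a b A₀ B₀ X₄ X₅ X₆ → T₁ :- T₂ :=
      (a :* (:- b :- B₀) :+ (:- T₂ :- B₀ :* (:- a :- A₀)) :+ T₁ :+ (X₄ :+ X₅ :+ X₆)) :+ (:- (A₀ :* B₀) :+ b :* a :- X₅ :- X₄ :- X₆)) refl
    cancel : ∀ A₀ B₀ a b X₄ X₅ X₆ → A₀ * B₀ + (- (A₀ * B₀) + b * a - X₅ - X₄ - X₆) ≈ b * a - X₅ - X₄ - X₆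
    cancel = solve 7 (λ A₀ B₀ a b X₄ X₅ X₆ → A₀ :* B₀ :+ (:- (A₀ :* B₀) :+ b :* a :- X₅ :- X₄ :- X₆) := b :* a :- X₅ :- X₄ :- X₆) refl

  reciprocity : sDed k (ℤ.- (+ c)) d (dil (+ c) f) (dil (ℤ.- b) f*) - sDed k (+ d) c (dil b f*) (dil (+ c) f)
                ≈ P₁C k ℚ.0ℚ (dil (ℤ.- b) f*) * P₁C k ℚ.0ℚ (dil (ℤ.- (+ c)) f)
                  - ι (+ d / c) * Bern₀ k f * P₂C k ℚ.0ℚ (dil b f*)
                  - ι (+ c / d) * Bern₀ k f* * P₂C k ℚ.0ℚ (dil (+ c) f)
                  - ι (_/_ (+ 1) (2 ℕ.* (d ℕ.* c)) {{m*n≢0 2 (d ℕ.* c) {{_}} {{m*n≢0 d c}}}}) * Bern₀ k f* * Bern₂ k f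
  reciprocity = begin
    sDed k (ℤ.- (+ c)) d fc (dil (ℤ.- b) f*) - sDed k (+ d) c fb fc ≈⟨ +-cong sDed-left≈T₁ (-‿cong sDed-right≈T₂) ⟩
    T₁ - T₂                       ≈⟨ solve-for-T₁-T₂ T₁ T₂ A₁ B₁ (fc (+ 0)) (fb (+ 0)) (T₂-inner 0) X₄ X₅ X₆ lattice T₂-inner-0 ⟩
    B₁ * A₁ - X₅ - X₄ - X₆        ≈⟨ +-cong (+-cong (+-cong (*-cong P₁C[0,-b]≈B₁ P₁C[0,-c]≈A₁) (-‿cong X₅≈)) (-‿cong X₄≈)) (-‿cong X₆≈) ⟨
    _                             ∎
    where
    lattice : A₁ * (- B₁ - fb (+ 0)) + (- T₂ - fb (+ 0) * T₂-inner 0) + T₁ + (X₄ + X₅ + X₆) ≈ fc (+ 0) * fb (+ 0)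
    lattice = trans (sym (+-cong (+-cong (+-cong S₁≈ S₂≈) S₃≈) (+-cong (+-cong S₄≈ S₅≈) S₆≈)))
                    (trans (sym lattice-sum≈S) lattice-sum)

theorem4 : ∀ {a ℓ} (R : CommutativeRing a ℓ) (ι : ℚ → CommutativeRing.Carrier R) →
  IsQAlgebraMap R ι →
  let open CommutativeRing R
      open WithRing R ι
  in (k : ℕ) .{{_ : NonZero k}} →
     (f f* : Seq) → Periodic k f → Periodic k f* →
     (c d : ℕ) .{{_ : NonZero c}} .{{_ : NonZero d}} →
     Coprime c d → k ℕD.∣ d →
     (b : ℤ) → (+ d) ℤD.∣ (b ℤ.* (+ c) ℤ.+ + 1) →
     sDed k (ℤ.- (+ c)) d (dil (+ c) f) (dil (ℤ.- b) f*)
       - sDed k (+ d) c (dil b f*) (dil (+ c) f)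
     ≈ P₁C k 0ℚ (dil (ℤ.- b) f*) * P₁C k 0ℚ (dil (ℤ.- (+ c)) f)
       - ι (+ d / c) * Bern₀ k f * P₂C k 0ℚ (dil b f*)
       - ι (+ c / d) * Bern₀ k f* * P₂C k 0ℚ (dil (+ c) f)
       - ι (_/_ (+ 1) (2 ℕ.* (d ℕ.* c)) {{m*n≢0 2 (d ℕ.* c) {{_}} {{m*n≢0 d c}}}})
           * Bern₀ k f* * Bern₂ k f
theorem4 R ι hom k f f* f-periodic f*-periodic c d _ (ℕD.divides d' d≡d'k) b d∣bc+1
  with ∣ᵤ⇒∣ {+ d} {b ℤ.* + c ℤ.+ + 1} d∣bc+1
... | divides e bc+1≡ed =
  Reciprocity.reciprocity R ι hom k f f* f-periodic f*-periodic c d d' d≡d'k b e bc+1≡ed
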